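{- The syntactic category of multiplicative co-intuitionistic linear logic, described in the context, is a symmetric monoidal left-closed category.
   Context: Formulas are $A ::= \gamma\mid\bot\mid A\wp A\mid A\smallsetminus A$ ($\gamma$ ground). Typed terms in context $x:E\triangleright\kappa:\Gamma$ (with $\kappa:\Gamma$ a list of $p$-terms in a control area together with $m$-terms typed by the formulas of the list $\Gamma$) are generated by the rules: axiom $x:A\triangleright x:A$; cut (substitution of $M:A$ for the input variable of a derivation from $x:A$); $\bot$-intro adding $\mathtt{connect\ to}(R):\bot$ for $R$ already in $\kappa$; $\bot$-elim $x:\bot\triangleright\mathtt{postp}(x)$; $\wp$-intro forming $M_0\wp M_1:A\wp B$ from $M_0:A,M_1:B$; $\wp$-elim substituting $\mathtt{casel}\,N$, $\mathtt{caser}\,N$ for the inputs of derivations from $A$ and from $B$, where $N:A\wp B$; $\smallsetminus$-intro: from $\kappa:\Gamma,M:A$ and $y:B\triangleright\zeta:\Delta$ form $\kappa:\Gamma,\zeta[y:=\mathtt{y}(M)]:\Delta,\mathtt{mkc}(M,\mathtt{y}):A\smallsetminus B$; $\smallsetminus$-elim: from $\kappa:\Gamma,M:A\smallsetminus B$ and $y:A\triangleright\xi:\Delta,N:B$ form $\mathtt{postp}(y\mapsto N,M),\kappa:\Gamma,\xi[y:=\mathtt{y}(M)]:\Delta$. The syntactic category has formulas as objects and typed terms $x:E\triangleright\kappa:\Gamma$, modulo renaming of $x$, as morphisms, where $x:E\triangleright\kappa:\Gamma$ and $y:E\triangleright\zeta:\Gamma$ are identified iff $\kappa=\zeta[y:=x]$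 is derivable from the following equations in context: reflexivity, symmetry, transitivity and substitutivity of equality; $\wp$-$\beta$: $\zeta[x:=\mathtt{casel}(M_0\wp M_1)]=\zeta[x:=M_0]$, $\xi[y:=\mathtt{caser}(M_0\wp M_1)]=\xi[y:=M_1]$; $\wp$-$\eta$: $\mathtt{casel}(M)\wp\mathtt{caser}(M)=M$; $\smallsetminus$-$\beta$: $[\overline N[y:=\mathtt{y}(M)],\mathtt{postp}(z\mapsto L,\mathtt{mkc}(M,\mathtt{y})),\overline L[z:=\mathtt{mkc}(M,\mathtt{y})]]=[\overline N[y:=L[z:=M]],\overline L[z:=M]]$ (for $M:A$, $y:B\triangleright\overline N:\Delta$, $z:A\triangleright\overline L:\Lambda,L:B$); $\smallsetminus$-$\eta$: $[\mathtt{mkc}(\mathtt{x}(M),\mathtt{y}),\mathtt{postp}(x\mapsto\mathtt{y}(x),M)]=M$ for $M:A\smallsetminus B$; $\bot$-rewiring $\mathtt{connect\ to}(R_i)=\mathtt{connect\ to}(R_j)$; $\bot$-$\beta$: $[\kappa,\mathtt{postp}(\mathtt{connect\ to}(R))]=\kappa$; $\bot$-$\eta$: $\mathtt{connect\ to}(\mathtt{postp}(M))=M$. A symmetric monoidal category is left-closed if each functor $A\bullet-$ has a left adjoint $-\smallsetminus A$. -}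

module Defs where

open import Data.Nat using (ℕ; _≟_)
open import Data.List using (List; []; _∷_; _++_; map)
open import Data.List.Membership.Propositional using (_∈_)
open import Data.List.Relation.Binary.Permutation.Propositional using (_↭_; ↭-reflexive)
open import Relation.Nullary using (yes; no)
open import Relation.Binary.Structures using (IsEquivalence)
open import Relation.Binary.PropositionalEquality using (_≡_; refl; cong; trans)

infixr 6 _⅋_
infixl 7 _∖_

data Fm : Set where
  gnd : ℕ → Fm
  ⊥ᶠ  : Fm
  _⅋_ : Fm → Fm → Fm
  _∖_ : Fm → Fm → Fm

-- Raw terms.  Variables and names (the typewriter 𝚡, 𝚢) share one sort.

Var : Set
Var = ℕ

infixr 6 _⅋ₜ_

data Tm : Set where
  var        : Var → Tm
  ap         : Var → Tm → Tm
  connect-to : Tm → Tm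
  postp      : Tm → Tm
  postp↦     : Var → Tm → Tm → Tm     -- postp(y ↦ N , M)   (y bound in N)
  _⅋ₜ_       : Tm → Tm → Tm
  casel      : Tm → Tm
  caser      : Tm → Tm
  mkc        : Tm → Var → Tm

-- The body N of postp(y ↦ N , M)
-- only has y free (it comes from a derivation with input y), so
-- substitution for the (different) input variable does not enter it.
_⟦_≔_⟧ : Tm → Var → Tm → Tm
var y ⟦ x ≔ N ⟧ with y ≟ x
... | yes _ = N
... | no  _ = var y
ap y M ⟦ x ≔ N ⟧         = ap y (M ⟦ x ≔ N ⟧)
connect-to R ⟦ x ≔ N ⟧   = connect-to (R ⟦ x ≔ N ⟧)
postp M ⟦ x ≔ N ⟧        = postp (M ⟦ x ≔ N ⟧)
postp↦ y L M ⟦ x ≔ N ⟧   = postp↦ y L (M ⟦ x ≔ N ⟧)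
(M₀ ⅋ₜ M₁) ⟦ x ≔ N ⟧     = (M₀ ⟦ x ≔ N ⟧) ⅋ₜ (M₁ ⟦ x ≔ N ⟧)
casel M ⟦ x ≔ N ⟧        = casel (M ⟦ x ≔ N ⟧)
caser M ⟦ x ≔ N ⟧        = caser (M ⟦ x ≔ N ⟧)
mkc M y ⟦ x ≔ N ⟧        = mkc (M ⟦ x ≔ N ⟧) y

-- Configurations κ : Γ  — a control area of p-terms together with
-- m-terms typed by formulas (Γ = the formulas of the m-entries).

data Entry : Set where
  p : Tm → Entry
  m : Tm → Fm → Entry

Conf : Set
Conf = List Entry

substE : Entry → Var → Tm → Entry
substE (p R)   x N = p (R ⟦ x ≔ N ⟧)
substE (m M A) x N = m (M ⟦ x ≔ N ⟧) A

_⟪_≔_⟫ : Conf → Var → Tm → Conf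
[]      ⟪ x ≔ N ⟫ = []
(e ∷ κ) ⟪ x ≔ N ⟫ = substE e x N ∷ (κ ⟪ x ≔ N ⟫)

data Der : Var → Fm → Conf → Set where
  ax     : ∀ {x A} → Der x A (m (var x) A ∷ [])
  exch   : ∀ {x E κ κ′} → Der x E κ → κ ↭ κ′ → Der x E κ′
  cut    : ∀ {x E κ₁ κ₂ M A y ζ} →
           Der x E (κ₁ ++ m M A ∷ κ₂) → Der y A ζ →
           Der x E (κ₁ ++ (ζ ⟪ y ≔ M ⟫) ++ κ₂)
  ⊥-intro : ∀ {x E κ R} → Der x E κ → p R ∈ κ →
            Der x E (κ ++ m (connect-to R) ⊥ᶠ ∷ [])
  ⊥-elim : ∀ {x} → Der x ⊥ᶠ (p (postp (var x)) ∷ [])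
  ⅋-intro : ∀ {x E κ M₀ M₁ A B} →
            Der x E (κ ++ m M₀ A ∷ m M₁ B ∷ []) →
            Der x E (κ ++ m (M₀ ⅋ₜ M₁) (A ⅋ B) ∷ [])
  ⅋-elim : ∀ {x E κ N A B y ζ z ξ} →
           Der x E (κ ++ m N (A ⅋ B) ∷ []) → Der y A ζ → Der z B ξ →
           Der x E (κ ++ (ζ ⟪ y ≔ casel N ⟫) ++ (ξ ⟪ z ≔ caser N ⟫))
  ∖-intro : ∀ {x E κ M A y B ζ} →
            Der x E (κ ++ m M A ∷ []) → Der y B ζ →
            Der x E (κ ++ (ζ ⟪ y ≔ ap y M ⟫) ++ m (mkc M y) (A ∖ B) ∷ [])
  ∖-elim : ∀ {x E κ M A B y ξ N} →
           Der x E (κ ++ m M (A ∖ B) ∷ []) → Der y A (ξ ++ m N B ∷ []) →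
           Der x E (p (postp↦ y N M) ∷ κ ++ (ξ ⟪ y ≔ ap y M ⟫))

data Eq : Var → Fm → Conf → Conf → Set where
  eq-refl  : ∀ {x E κ} → Der x E κ → Eq x E κ κ
  eq-sym   : ∀ {x E κ κ′} → Eq x E κ κ′ → Eq x E κ′ κ
  eq-trans : ∀ {x E κ κ′ κ″} → Eq x E κ κ′ → Eq x E κ′ κ″ → Eq x E κ κ″
  eq-exch  : ∀ {x E κ κ′ μ μ′} → Eq x E κ κ′ → κ ↭ μ → κ′ ↭ μ′ → Eq x E μ μ′
  cong-cut : ∀ {x E κ₁ κ₂ κ₁′ κ₂′ M M′ A y ζ ζ′} →
             Eq x E (κ₁ ++ m M A ∷ κ₂) (κ₁′ ++ m M′ A ∷ κ₂′) → Eq y A ζ ζ′ →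
             Eq x E (κ₁ ++ (ζ ⟪ y ≔ M ⟫) ++ κ₂) (κ₁′ ++ (ζ′ ⟪ y ≔ M′ ⟫) ++ κ₂′)
  cong-⊥-intro : ∀ {x E κ κ′ R R′} →
             Eq x E (κ ++ p R ∷ []) (κ′ ++ p R′ ∷ []) →
             Eq x E (κ ++ p R ∷ m (connect-to R) ⊥ᶠ ∷ [])
                    (κ′ ++ p R′ ∷ m (connect-to R′) ⊥ᶠ ∷ [])
  cong-⅋-intro : ∀ {x E κ κ′ M₀ M₁ M₀′ M₁′ A B} →
             Eq x E (κ ++ m M₀ A ∷ m M₁ B ∷ []) (κ′ ++ m M₀′ A ∷ m M₁′ B ∷ []) →
             Eq x E (κ ++ m (M₀ ⅋ₜ M₁) (A ⅋ B) ∷ []) (κ′ ++ m (M₀′ ⅋ₜ M₁′) (A ⅋ B) ∷ [])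
  cong-⅋-elim : ∀ {x E κ κ′ N N′ A B y ζ ζ′ z ξ ξ′} →
             Eq x E (κ ++ m N (A ⅋ B) ∷ []) (κ′ ++ m N′ (A ⅋ B) ∷ []) →
             Eq y A ζ ζ′ → Eq z B ξ ξ′ →
             Eq x E (κ ++ (ζ ⟪ y ≔ casel N ⟫) ++ (ξ ⟪ z ≔ caser N ⟫))
                    (κ′ ++ (ζ′ ⟪ y ≔ casel N′ ⟫) ++ (ξ′ ⟪ z ≔ caser N′ ⟫))
  cong-∖-intro : ∀ {x E κ κ′ M M′ A y B ζ ζ′} →
             Eq x E (κ ++ m M A ∷ []) (κ′ ++ m M′ A ∷ []) → Eq y B ζ ζ′ →
             Eq x E (κ ++ (ζ ⟪ y ≔ ap y M ⟫) ++ m (mkc M y) (A ∖ B) ∷ [])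
                    (κ′ ++ (ζ′ ⟪ y ≔ ap y M′ ⟫) ++ m (mkc M′ y) (A ∖ B) ∷ [])
  cong-∖-elim : ∀ {x E κ κ′ M M′ A B y ξ ξ′ N N′} →
             Eq x E (κ ++ m M (A ∖ B) ∷ []) (κ′ ++ m M′ (A ∖ B) ∷ []) →
             Eq y A (ξ ++ m N B ∷ []) (ξ′ ++ m N′ B ∷ []) →
             Eq x E (p (postp↦ y N M) ∷ κ ++ (ξ ⟪ y ≔ ap y M ⟫))
                    (p (postp↦ y N′ M′) ∷ κ′ ++ (ξ′ ⟪ y ≔ ap y M′ ⟫))
  ⅋-β : ∀ {x E κ M₀ M₁ A B y ζ z ξ} →
        Der x E (κ ++ m M₀ A ∷ m M₁ B ∷ []) → Der y A ζ → Der z B ξ →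
        Eq x E (κ ++ (ζ ⟪ y ≔ casel (M₀ ⅋ₜ M₁) ⟫) ++ (ξ ⟪ z ≔ caser (M₀ ⅋ₜ M₁) ⟫))
               (κ ++ (ζ ⟪ y ≔ M₀ ⟫) ++ (ξ ⟪ z ≔ M₁ ⟫))
  ⅋-η : ∀ {x E κ M A B} → Der x E (κ ++ m M (A ⅋ B) ∷ []) →
        Eq x E (κ ++ m (casel M ⅋ₜ caser M) (A ⅋ B) ∷ []) (κ ++ m M (A ⅋ B) ∷ [])
  ∖-β : ∀ {x E κ M A y B N̄ z L̄ L} →
        Der x E (κ ++ m M A ∷ []) → Der y B N̄ → Der z A (L̄ ++ m L B ∷ []) →
        Eq x E (κ ++ (N̄ ⟪ y ≔ ap y M ⟫) ++ p (postp↦ z L (mkc M y))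
                   ∷ (L̄ ⟪ z ≔ ap z (mkc M y) ⟫))
               (κ ++ (N̄ ⟪ y ≔ L ⟦ z ≔ M ⟧ ⟫) ++ (L̄ ⟪ z ≔ M ⟫))
  ∖-η : ∀ {x E κ M A B u v} → Der x E (κ ++ m M (A ∖ B) ∷ []) →
        Eq x E (κ ++ m (mkc (ap u M) v) (A ∖ B) ∷ p (postp↦ u (ap v (var u)) M) ∷ [])
               (κ ++ m M (A ∖ B) ∷ [])
  ⊥-rewire : ∀ {x E κ R R′} → Der x E κ → p R ∈ κ → p R′ ∈ κ →
        Eq x E (κ ++ m (connect-to R) ⊥ᶠ ∷ []) (κ ++ m (connect-to R′) ⊥ᶠ ∷ [])
  ⊥-β : ∀ {x E κ R} → Der x E κ → p R ∈ κ →
        Eq x E (κ ++ p (postp (connect-to R)) ∷ []) κ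
  ⊥-η : ∀ {x E κ M} → Der x E (κ ++ m M ⊥ᶠ ∷ []) →
        Eq x E (κ ++ p (postp M) ∷ m (connect-to (postp M)) ⊥ᶠ ∷ []) (κ ++ m M ⊥ᶠ ∷ [])

record CatData : Set₁ where
  infix  4 _≈_
  infixr 9 _∘_
  field
    Obj : Set
    Hom : Obj → Obj → Set
    _≈_ : ∀ {A B} → Hom A B → Hom A B → Set
    id  : ∀ {A} → Hom A A
    _∘_ : ∀ {A B C} → Hom B C → Hom A B → Hom A C

record IsCategory (C : CatData) : Set where
  open CatData C
  field
    ≈-equiv : ∀ {A B} → IsEquivalence (_≈_ {A} {B})
    ∘-resp  : ∀ {A B D} {f f′ : Hom B D} {g g′ : Hom A B} →
              f ≈ f′ → g ≈ g′ → f ∘ g ≈ f′ ∘ g′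
    identityˡ : ∀ {A B} {f : Hom A B} → id ∘ f ≈ f
    identityʳ : ∀ {A B} {f : Hom A B} → f ∘ id ≈ f
    assoc     : ∀ {A B D E} {f : Hom A B} {g : Hom B D} {h : Hom D E} →
                (h ∘ g) ∘ f ≈ h ∘ (g ∘ f)

record SymmetricMonoidal (C : CatData) (_⊗₀_ : CatData.Obj C → CatData.Obj C → CatData.Obj C)
                         (I : CatData.Obj C) : Set where
  open CatData C
  field
    _⊗₁_   : ∀ {A B A′ B′} → Hom A A′ → Hom B B′ → Hom (A ⊗₀ B) (A′ ⊗₀ B′)
    ⊗-resp : ∀ {A B A′ B′} {f f′ : Hom A A′} {g g′ : Hom B B′} →
             f ≈ f′ → g ≈ g′ → (f ⊗₁ g) ≈ (f′ ⊗₁ g′)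
    ⊗-id   : ∀ {A B} → (id {A} ⊗₁ id {B}) ≈ id
    ⊗-∘    : ∀ {A B A′ B′ A″ B″} {f : Hom A A′} {f′ : Hom A′ A″} {g : Hom B B′} {g′ : Hom B′ B″} →
             ((f′ ∘ f) ⊗₁ (g′ ∘ g)) ≈ ((f′ ⊗₁ g′) ∘ (f ⊗₁ g))
    α⇒ : ∀ {A B D} → Hom ((A ⊗₀ B) ⊗₀ D) (A ⊗₀ (B ⊗₀ D))
    α⇐ : ∀ {A B D} → Hom (A ⊗₀ (B ⊗₀ D)) ((A ⊗₀ B) ⊗₀ D)
    α-isoˡ : ∀ {A B D} → α⇐ {A} {B} {D} ∘ α⇒ ≈ id
    α-isoʳ : ∀ {A B D} → α⇒ {A} {B} {D} ∘ α⇐ ≈ id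
    α-natural : ∀ {A B D A′ B′ D′} {f : Hom A A′} {g : Hom B B′} {h : Hom D D′} →
                α⇒ ∘ ((f ⊗₁ g) ⊗₁ h) ≈ (f ⊗₁ (g ⊗₁ h)) ∘ α⇒
    unitˡ⇒ : ∀ {A} → Hom (I ⊗₀ A) A
    unitˡ⇐ : ∀ {A} → Hom A (I ⊗₀ A)
    unitˡ-isoˡ : ∀ {A} → unitˡ⇐ {A} ∘ unitˡ⇒ ≈ id
    unitˡ-isoʳ : ∀ {A} → unitˡ⇒ {A} ∘ unitˡ⇐ ≈ id
    unitˡ-natural : ∀ {A A′} {f : Hom A A′} → unitˡ⇒ ∘ (id ⊗₁ f) ≈ f ∘ unitˡ⇒
    unitʳ⇒ : ∀ {A} → Hom (A ⊗₀ I) A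
    unitʳ⇐ : ∀ {A} → Hom A (A ⊗₀ I)
    unitʳ-isoˡ : ∀ {A} → unitʳ⇐ {A} ∘ unitʳ⇒ ≈ id
    unitʳ-isoʳ : ∀ {A} → unitʳ⇒ {A} ∘ unitʳ⇐ ≈ id
    unitʳ-natural : ∀ {A A′} {f : Hom A A′} → unitʳ⇒ ∘ (f ⊗₁ id) ≈ f ∘ unitʳ⇒
    σ : ∀ {A B} → Hom (A ⊗₀ B) (B ⊗₀ A)
    σ-natural : ∀ {A B A′ B′} {f : Hom A A′} {g : Hom B B′} →
                σ ∘ (f ⊗₁ g) ≈ (g ⊗₁ f) ∘ σ
    σ-involutive : ∀ {A B} → σ {B} {A} ∘ σ {A} {B} ≈ id
    triangle : ∀ {A B} → (id {A} ⊗₁ unitˡ⇒ {B}) ∘ α⇒ ≈ (unitʳ⇒ ⊗₁ id)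
    pentagon : ∀ {A B D E} →
               (id {A} ⊗₁ α⇒ {B} {D} {E}) ∘ (α⇒ ∘ (α⇒ ⊗₁ id)) ≈ α⇒ ∘ α⇒
    hexagon  : ∀ {A B D} →
               α⇒ {B} {D} {A} ∘ (σ {A} {B ⊗₀ D} ∘ α⇒) ≈ (id ⊗₁ σ) ∘ (α⇒ ∘ (σ ⊗₁ id))

-- Left-closedness: for every A the functor A ⊗ - has a left adjoint
-- given on objects by  B ↦ L A B .
record LeftClosed (C : CatData) {_⊗₀_ : CatData.Obj C → CatData.Obj C → CatData.Obj C}
                  {I : CatData.Obj C} (M : SymmetricMonoidal C _⊗₀_ I)
                  (L : CatData.Obj C → CatData.Obj C → CatData.Obj C) : Set where
  open CatData C
  open SymmetricMonoidal M
  field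
    L₁      : ∀ A {B D} → Hom B D → Hom (L A B) (L A D)
    L-resp  : ∀ A {B D} {f g : Hom B D} → f ≈ g → L₁ A f ≈ L₁ A g
    L-id    : ∀ A {B} → L₁ A (id {B}) ≈ id
    L-∘     : ∀ A {B D E} {f : Hom B D} {g : Hom D E} → L₁ A (g ∘ f) ≈ L₁ A g ∘ L₁ A f
    η       : ∀ A B → Hom B (A ⊗₀ L A B)
    ε       : ∀ A B → Hom (L A (A ⊗₀ B)) B
    η-natural : ∀ A {B D} {f : Hom B D} → (id ⊗₁ L₁ A f) ∘ η A B ≈ η A D ∘ f
    ε-natural : ∀ A {B D} {f : Hom B D} → f ∘ ε A B ≈ ε A D ∘ L₁ A (id ⊗₁ f)
    zig     : ∀ A B → (id ⊗₁ ε A B) ∘ η A (A ⊗₀ B) ≈ id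
    zag     : ∀ A B → ε A (L A B) ∘ L₁ A (η A B) ≈ id

-- a morphism E → A : a typed term  x : E ▷ κ : A , with κ written as its
-- control area (list of p-terms) followed by its single m-term of type A
record SynHom (E A : Fm) : Set where
  constructor mor
  field
    inp  : Var
    ctl  : List Tm
    out  : Tm
    der  : Der inp E (map p ctl ++ m out A ∷ [])

-- x : E ▷ κ  and  y : E ▷ ζ  are identified iff  κ = ζ[y:=x]
_≈Syn_ : ∀ {E A} → SynHom E A → SynHom E A → Set
_≈Syn_ {E} {A} (mor x ps M _) (mor y qs N _) =
  Eq x E (map p ps ++ m M A ∷ []) ((map p qs ++ m N A ∷ []) ⟪ y ≔ var x ⟫)

private
  subst-lem : ∀ (qs : List Tm) N B y M →
    (map p qs ++ m N B ∷ []) ⟪ y ≔ M ⟫ ≡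
    map p (map (λ t → t ⟦ y ≔ M ⟧) qs) ++ m (N ⟦ y ≔ M ⟧) B ∷ []
  subst-lem []       N B y M = refl
  subst-lem (q ∷ qs) N B y M = cong (p (q ⟦ y ≔ M ⟧) ∷_) (subst-lem qs N B y M)

  assoc-lem : ∀ (ps qs : List Tm) (e : Entry) →
    map p ps ++ (map p qs ++ e ∷ []) ++ [] ≡ map p (ps ++ qs) ++ e ∷ []
  assoc-lem []       []       e = refl
  assoc-lem []       (q ∷ qs) e = cong (p q ∷_) (assoc-lem [] qs e)
  assoc-lem (r ∷ ps) qs       e = cong (p r ∷_) (assoc-lem ps qs e)

idSyn : ∀ {A} → SynHom A A
idSyn = mor 0 [] (var 0) ax

_∘Syn_ : ∀ {E A B} → SynHom A B → SynHom E A → SynHom E B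
_∘Syn_ {E} {A} {B} (mor y qs N e) (mor x ps M d) =
  mor x (ps ++ map (λ t → t ⟦ y ≔ M ⟧) qs) (N ⟦ y ≔ M ⟧)
      (exch (cut {κ₁ = map p ps} {κ₂ = []} d e)
            (↭-reflexive (trans (cong (λ z → map p ps ++ z ++ [])
                                      (subst-lem qs N B y M))
                                (assoc-lem ps (map (λ t → t ⟦ y ≔ M ⟧) qs)
                                           (m (N ⟦ y ≔ M ⟧) B)))))

Syn : CatData
Syn = record
  { Obj = Fm
  ; Hom = SynHom
  ; _≈_ = _≈Syn_
  ; id  = idSyn
  ; _∘_ = _∘Syn_
  }

module Submission where

-- Every derivation mentions only its input
-- variable freely (der-closed); hence iterated substitutions compose, which
-- gives the category laws.
--
-- The monoidal structure is handled uniformly through ⅋-shapes: a shape of A is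
-- a binary ⅋-tree with leaves; a tuple over a shape is one term per leaf.
-- Projecting a term to a tuple (casel/caser) and pairing a tuple back (⅋ₜ) are
-- mutually inverse up to ⅋-β (apply-β) and ⅋-η (tuple-η).  The tensor f ⊗ g is
-- a tree of morphisms acting leafwise; the associator and the symmetry are
-- wirings, i.e. morphisms that merely rearrange the leaves of a tuple.  Wirings
-- compose like their rearrangements (wiring-∘), and once α and σ are written
-- over fully expanded shapes the pentagon and hexagon become definitional
-- equalities of rearrangements.  The unitors combine ⊥-elim with a ∖-loop
-- feeding ⊥-intro; their laws come from ⊥-β, ⊥-η, ⊥-rewiring and ∖-β.
-- Finally - ∖ A is a functor through ∖-intro/∖-elim, with unit
-- B → A ⅋ (B ∖ A) and counit (A ⅋ B) ∖ A → B; their laws reduce to ∖-β and ∖-η.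

open import Defs
open import Data.Nat using (_≟_)
open import Data.Product using (Σ; _×_; _,_)
open import Data.Empty using () renaming (⊥-elim to absurd)
open import Data.List using (List; []; _∷_; _++_; map)
open import Data.List.Properties using (map-++; ++-assoc; ++-identityʳ)
open import Data.List.Relation.Unary.All as All using (All; []; _∷_)
open import Data.List.Relation.Unary.All.Properties using (++⁺; ++⁻ˡ; ++⁻ʳ)
open import Data.List.Relation.Unary.Any using (here; there)
open import Data.List.Relation.Binary.Permutation.Propositional
  using (_↭_; prep; swap; ↭-refl; ↭-reflexive; ↭-sym; ↭-trans)
open import Data.List.Relation.Binary.Permutation.Propositional.Properties
  using (All-resp-↭; ++⁺ˡ; ++⁺ʳ; shift; shifts; ++-comm; ∷↭∷ʳ)
  renaming (++⁺ to ++⁺-↭)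
open import Relation.Nullary using (yes; no)
open import Level using (0ℓ)
open import Relation.Binary.Structures using (IsEquivalence)
open import Relation.Binary.Bundles using (Setoid)
import Relation.Binary.Reasoning.Setoid as SetoidReasoning
open import Relation.Binary.PropositionalEquality
  using (_≡_; refl; sym; trans; cong; cong₂; subst; module ≡-Reasoning)

open SynHom

-- A term is closed in x when x is its only free variable (the bodies of
-- postp↦ are never substituted into, so they do not count).
Closed : Var → Tm → Set
Closed x (var y)         = y ≡ x
Closed x (ap _ M)        = Closed x M
Closed x (connect-to R)  = Closed x R
Closed x (postp M)       = Closed x M
Closed x (postp↦ _ _ M)  = Closed x M
Closed x (M ⅋ₜ N)        = Closed x M × Closed x N
Closed x (casel M)       = Closed x M
Closed x (caser M)       = Closed x M
Closed x (mkc M _)       = Closed x M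

ClosedE : Var → Entry → Set
ClosedE x (p R)   = Closed x R
ClosedE x (m M _) = Closed x M

ClosedC : Var → Conf → Set
ClosedC x = All (ClosedE x)

subst-self : ∀ t x → t ⟦ x ≔ var x ⟧ ≡ t
subst-self (var y) x with y ≟ x
... | yes refl = refl
... | no _     = refl
subst-self (ap y t) x        = cong (ap y) (subst-self t x)
subst-self (connect-to t) x  = cong connect-to (subst-self t x)
subst-self (postp t) x       = cong postp (subst-self t x)
subst-self (postp↦ y L t) x  = cong (postp↦ y L) (subst-self t x)
subst-self (t ⅋ₜ u) x        = cong₂ _⅋ₜ_ (subst-self t x) (subst-self u x)
subst-self (casel t) x       = cong casel (subst-self t x)
subst-self (caser t) x       = cong caser (subst-self t x)
subst-self (mkc t y) x       = cong (λ z → mkc z y) (subst-self t x)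

subst-var : ∀ x M → var x ⟦ x ≔ M ⟧ ≡ M
subst-var x M with x ≟ x
... | yes _ = refl
... | no x≢x = absurd (x≢x refl)

subst-compose : ∀ t y M z N → Closed y t → (t ⟦ y ≔ M ⟧) ⟦ z ≔ N ⟧ ≡ t ⟦ y ≔ M ⟦ z ≔ N ⟧ ⟧
subst-compose (var _) y M z N refl =
  trans (cong (_⟦ z ≔ N ⟧) (subst-var y M)) (sym (subst-var y _))
subst-compose (ap v t) y M z N c        = cong (ap v) (subst-compose t y M z N c)
subst-compose (connect-to t) y M z N c  = cong connect-to (subst-compose t y M z N c)
subst-compose (postp t) y M z N c       = cong postp (subst-compose t y M z N c)
subst-compose (postp↦ v L t) y M z N c  = cong (postp↦ v L) (subst-compose t y M z N c)
subst-compose (t ⅋ₜ u) y M z N (c , d)  =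
  cong₂ _⅋ₜ_ (subst-compose t y M z N c) (subst-compose u y M z N d)
subst-compose (casel t) y M z N c       = cong casel (subst-compose t y M z N c)
subst-compose (caser t) y M z N c       = cong caser (subst-compose t y M z N c)
subst-compose (mkc t v) y M z N c       = cong (λ q → mkc q v) (subst-compose t y M z N c)

subst-closed : ∀ t y M x → Closed y t → Closed x M → Closed x (t ⟦ y ≔ M ⟧)
subst-closed (var _) y M x refl c = subst (Closed x) (sym (subst-var y M)) c
subst-closed (ap _ t) y M x d c        = subst-closed t y M x d c
subst-closed (connect-to t) y M x d c  = subst-closed t y M x d c
subst-closed (postp t) y M x d c       = subst-closed t y M x d c
subst-closed (postp↦ _ _ t) y M x d c  = subst-closed t y M x d c
subst-closed (t ⅋ₜ u) y M x (d , e) c  = subst-closed t y M x d c , subst-closed u y M x e c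
subst-closed (casel t) y M x d c       = subst-closed t y M x d c
subst-closed (caser t) y M x d c       = subst-closed t y M x d c
subst-closed (mkc t _) y M x d c       = subst-closed t y M x d c

csubst-self : ∀ κ x → κ ⟪ x ≔ var x ⟫ ≡ κ
csubst-self [] x = refl
csubst-self (p R ∷ κ) x   = cong₂ _∷_ (cong p (subst-self R x)) (csubst-self κ x)
csubst-self (m M A ∷ κ) x = cong₂ _∷_ (cong (λ t → m t A) (subst-self M x)) (csubst-self κ x)

csubst-compose : ∀ κ y M z N → ClosedC y κ → (κ ⟪ y ≔ M ⟫) ⟪ z ≔ N ⟫ ≡ κ ⟪ y ≔ M ⟦ z ≔ N ⟧ ⟫
csubst-compose [] y M z N c = refl
csubst-compose (p R ∷ κ) y M z N (c ∷ cs) =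
  cong₂ _∷_ (cong p (subst-compose R y M z N c)) (csubst-compose κ y M z N cs)
csubst-compose (m R A ∷ κ) y M z N (c ∷ cs) =
  cong₂ _∷_ (cong (λ t → m t A) (subst-compose R y M z N c)) (csubst-compose κ y M z N cs)

csubst-closed : ∀ κ y M x → ClosedC y κ → Closed x M → ClosedC x (κ ⟪ y ≔ M ⟫)
csubst-closed [] y M x c d = []
csubst-closed (p R ∷ κ) y M x (c ∷ cs) d   = subst-closed R y M x c d ∷ csubst-closed κ y M x cs d
csubst-closed (m R A ∷ κ) y M x (c ∷ cs) d = subst-closed R y M x c d ∷ csubst-closed κ y M x cs d

csubst-++ : ∀ κ μ y M → (κ ++ μ) ⟪ y ≔ M ⟫ ≡ (κ ⟪ y ≔ M ⟫) ++ (μ ⟪ y ≔ M ⟫)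
csubst-++ [] μ y M = refl
csubst-++ (e ∷ κ) μ y M = cong (substE e y M ∷_) (csubst-++ κ μ y M)

subs : Var → Tm → List Tm → List Tm
subs y M = map (λ t → t ⟦ y ≔ M ⟧)

csubst-map : ∀ ps y M → (map p ps) ⟪ y ≔ M ⟫ ≡ map p (subs y M ps)
csubst-map [] y M = refl
csubst-map (q ∷ ps) y M = cong (p (q ⟦ y ≔ M ⟧) ∷_) (csubst-map ps y M)

subs-compose : ∀ ps x N y M → All (ClosedE x) (map p ps) → subs y M (subs x N ps) ≡ subs x (N ⟦ y ≔ M ⟧) ps
subs-compose [] x N y M _ = refl
subs-compose (q ∷ ps) x N y M (c ∷ cs) = cong₂ _∷_ (subst-compose q x N y M c) (subs-compose ps x N y M cs)

der-closed : ∀ {x E κ} → Der x E κ → ClosedC x κ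
der-closed ax = refl ∷ []
der-closed (exch d π) = All-resp-↭ π (der-closed d)
der-closed (cut {κ₁ = κ₁} {M = M} {y = y} {ζ} d e) =
  let c = der-closed d ; cM = ++⁻ʳ κ₁ c in
  ++⁺ (++⁻ˡ κ₁ c) (++⁺ (csubst-closed ζ y M _ (der-closed e) (All.head cM)) (All.tail cM))
der-closed (⊥-intro d i) = ++⁺ (der-closed d) (All.lookup (der-closed d) i ∷ [])
der-closed ⊥-elim = refl ∷ []
der-closed (⅋-intro {κ = κ} d) =
  let c = der-closed d ; c₂ = ++⁻ʳ κ c in
  ++⁺ (++⁻ˡ κ c) ((All.head c₂ , All.head (All.tail c₂)) ∷ [])
der-closed (⅋-elim {κ = κ} {y = y} {ζ} {z} {ξ} d e f) =
  let c = der-closed d ; cN = All.head (++⁻ʳ κ c) in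
  ++⁺ (++⁻ˡ κ c) (++⁺ (csubst-closed ζ y _ _ (der-closed e) cN) (csubst-closed ξ z _ _ (der-closed f) cN))
der-closed (∖-intro {κ = κ} {y = y} {ζ = ζ} d e) =
  let c = der-closed d ; cM = All.head (++⁻ʳ κ c) in
  ++⁺ (++⁻ˡ κ c) (++⁺ (csubst-closed ζ y _ _ (der-closed e) cM) (cM ∷ []))
der-closed (∖-elim {κ = κ} {y = y} {ξ} d e) =
  let c = der-closed d ; cM = All.head (++⁻ʳ κ c) in
  cM ∷ ++⁺ (++⁻ˡ κ c) (csubst-closed ξ y _ _ (++⁻ˡ ξ (der-closed e)) cM)

der-cast : ∀ {x E κ μ} → Der x E κ → κ ≡ μ → Der x E μ
der-cast d refl = d

eq-cast : ∀ {x E κ κ′ μ μ′} → Eq x E κ μ → κ ≡ κ′ → μ ≡ μ′ → Eq x E κ′ μ′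
eq-cast e refl refl = e

eq-refl≡ : ∀ {x E κ μ} → Der x E κ → κ ≡ μ → Eq x E κ μ
eq-refl≡ d refl = eq-refl d

infixr 2 _⨾_
_⨾_ : ∀ {x E κ κ′ κ″} → Eq x E κ κ′ → Eq x E κ′ κ″ → Eq x E κ κ″
_⨾_ = eq-trans

der-rename : ∀ {y A ζ} z → Der y A ζ → Der z A (ζ ⟪ y ≔ var z ⟫)
der-rename z d = der-cast (cut {κ₁ = []} {κ₂ = []} ax d) (++-identityʳ _)

eq-rename : ∀ {y A ζ ζ′} z → Eq y A ζ ζ′ → Eq z A (ζ ⟪ y ≔ var z ⟫) (ζ′ ⟪ y ≔ var z ⟫)
eq-rename z e = eq-cast (cong-cut {κ₁ = []} {κ₂ = []} {κ₁′ = []} {κ₂′ = []} (eq-refl ax) e)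
                        (++-identityʳ _) (++-identityʳ _)

der-cutLast : ∀ {x E κ M A y ζ} → Der x E (κ ++ m M A ∷ []) → Der y A ζ → Der x E (κ ++ ζ ⟪ y ≔ M ⟫)
der-cutLast {κ = κ} d e = der-cast (cut {κ₁ = κ} {κ₂ = []} d e) (cong (κ ++_) (++-identityʳ _))

eq-cutLast : ∀ {x E κ κ′ M M′ A y ζ ζ′} → Eq x E (κ ++ m M A ∷ []) (κ′ ++ m M′ A ∷ []) →
             Eq y A ζ ζ′ → Eq x E (κ ++ ζ ⟪ y ≔ M ⟫) (κ′ ++ ζ′ ⟪ y ≔ M′ ⟫)
eq-cutLast {κ = κ} {κ′} e f = eq-cast (cong-cut {κ₁ = κ} {κ₂ = []} {κ₁′ = κ′} {κ₂′ = []} e f)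
  (cong (κ ++_) (++-identityʳ _)) (cong (κ′ ++_) (++-identityʳ _))

conf : ∀ {E A} → SynHom E A → Conf
conf {A = A} f = map p (ctl f) ++ m (out f) A ∷ []

closed : ∀ {E A} (f : SynHom E A) → ClosedC (inp f) (conf f)
closed f = der-closed (der f)

ctl-closed : ∀ {E A} (f : SynHom E A) → All (ClosedE (inp f)) (map p (ctl f))
ctl-closed f = ++⁻ˡ (map p (ctl f)) (closed f)

out-closed : ∀ {E A} (f : SynHom E A) → Closed (inp f) (out f)
out-closed f = All.head (++⁻ʳ (map p (ctl f)) (closed f))

conf-subst : ∀ {E A} (f : SynHom E A) y M →
             conf f ⟪ y ≔ M ⟫ ≡ map p (subs y M (ctl f)) ++ m (out f ⟦ y ≔ M ⟧) A ∷ []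
conf-subst {A = A} f y M =
  trans (csubst-++ (map p (ctl f)) (m (out f) A ∷ []) y M)
        (cong (_++ m (out f ⟦ y ≔ M ⟧) A ∷ []) (csubst-map (ctl f) y M))

conf-∘ : ∀ {E A B} (g : SynHom A B) (f : SynHom E A) →
         conf (g ∘Syn f) ≡ map p (ctl f) ++ conf g ⟪ inp g ≔ out f ⟫
conf-∘ {B = B} g f = begin
  map p (ctl f ++ subs (inp g) (out f) (ctl g)) ++ [ N ]
    ≡⟨ cong (_++ [ N ]) (map-++ p (ctl f) _) ⟩
  (map p (ctl f) ++ map p (subs (inp g) (out f) (ctl g))) ++ [ N ]
    ≡⟨ ++-assoc (map p (ctl f)) _ _ ⟩
  map p (ctl f) ++ map p (subs (inp g) (out f) (ctl g)) ++ [ N ]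
    ≡⟨ cong (map p (ctl f) ++_) (sym (conf-subst g (inp g) (out f))) ⟩
  map p (ctl f) ++ conf g ⟪ inp g ≔ out f ⟫ ∎
  where
  open ≡-Reasoning
  N = m (out g ⟦ inp g ≔ out f ⟧) B
  [_] : Entry → Conf
  [ e ] = e ∷ []

conf-∘-subst : ∀ {E A B} (g : SynHom A B) (f : SynHom E A) N →
  conf (g ∘Syn f) ⟪ inp f ≔ N ⟫ ≡ map p (subs (inp f) N (ctl f)) ++ conf g ⟪ inp g ≔ out f ⟦ inp f ≔ N ⟧ ⟫
conf-∘-subst g f N = begin
  conf (g ∘Syn f) ⟪ x ≔ N ⟫
    ≡⟨ cong (_⟪ x ≔ N ⟫) (conf-∘ g f) ⟩
  (map p (ctl f) ++ conf g ⟪ inp g ≔ out f ⟫) ⟪ x ≔ N ⟫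
    ≡⟨ csubst-++ (map p (ctl f)) _ x N ⟩
  map p (ctl f) ⟪ x ≔ N ⟫ ++ conf g ⟪ inp g ≔ out f ⟫ ⟪ x ≔ N ⟫
    ≡⟨ cong₂ _++_ (csubst-map (ctl f) x N) (csubst-compose (conf g) (inp g) (out f) x N (closed g)) ⟩
  map p (subs x N (ctl f)) ++ conf g ⟪ inp g ≔ out f ⟦ x ≔ N ⟧ ⟫ ∎
  where
  open ≡-Reasoning
  x = inp f

rename-subst : ∀ {E A} (g : SynHom E A) x N → conf g ⟪ inp g ≔ var x ⟫ ⟪ x ≔ N ⟫ ≡ conf g ⟪ inp g ≔ N ⟫
rename-subst g x N = trans (csubst-compose (conf g) (inp g) (var x) x N (closed g))
                           (cong (λ t → conf g ⟪ inp g ≔ t ⟫) (subst-var x N))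

≈-by-eq : ∀ {E A} (f g : SynHom E A) → inp f ≡ inp g → Eq (inp f) E (conf f) (conf g) → f ≈Syn g
≈-by-eq f g refl e = eq-cast e refl (sym (csubst-self (conf g) (inp g)))

≈-by-conf : ∀ {E A} (f g : SynHom E A) → inp f ≡ inp g → conf f ≡ conf g → f ≈Syn g
≈-by-conf f g refl eq = ≈-by-eq f g refl (eq-refl≡ (der f) eq)

≈-refl : ∀ {E A} {f : SynHom E A} → f ≈Syn f
≈-refl {f = f} = ≈-by-conf f f refl refl

≈-sym : ∀ {E A} {f g : SynHom E A} → f ≈Syn g → g ≈Syn f
≈-sym {f = f} {g} e = eq-sym (eq-cast (eq-rename (inp g) e) refl
  (trans (rename-subst g (inp f) (var (inp g))) (csubst-self (conf g) (inp g))))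

≈-trans : ∀ {E A} {f g h : SynHom E A} → f ≈Syn g → g ≈Syn h → f ≈Syn h
≈-trans {f = f} {g} {h} e₁ e₂ =
  e₁ ⨾ eq-cast (eq-rename (inp f) e₂) refl (rename-subst h (inp g) (var (inp f)))

≈-equiv : ∀ {A B} → IsEquivalence (_≈Syn_ {A} {B})
≈-equiv = record
  { refl  = λ {f} → ≈-refl {f = f}
  ; sym   = λ {f} {g} → ≈-sym {f = f} {g}
  ; trans = λ {f} {g} {h} → ≈-trans {f = f} {g} {h}
  }

hom-setoid : Fm → Fm → Setoid 0ℓ 0ℓ
hom-setoid E A = record { Carrier = SynHom E A ; _≈_ = _≈Syn_ ; isEquivalence = ≈-equiv }

module ≈-Reasoning {E A : Fm} = SetoidReasoning (hom-setoid E A)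

-- Composition respects ≈: congruence of cut.
-- (The morphisms are explicit: they cannot be recovered from an equation.)
∘-resp : ∀ {A B D} (f f′ : SynHom B D) (g g′ : SynHom A B) →
         f ≈Syn f′ → g ≈Syn g′ → (f ∘Syn g) ≈Syn (f′ ∘Syn g′)
∘-resp f f′ g g′ ef eg =
  eq-cast (eq-cutLast (eq-cast eg refl (conf-subst g′ (inp g′) x)) ef) (sym (conf-∘ f g)) (begin
    map p (subs (inp g′) x (ctl g′)) ++ conf f′ ⟪ inp f′ ≔ var (inp f) ⟫ ⟪ inp f ≔ N ⟫
      ≡⟨ cong (map p (subs (inp g′) x (ctl g′)) ++_) (rename-subst f′ (inp f) N) ⟩
    map p (subs (inp g′) x (ctl g′)) ++ conf f′ ⟪ inp f′ ≔ N ⟫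
      ≡⟨ sym (conf-∘-subst f′ g′ x) ⟩
    conf (f′ ∘Syn g′) ⟪ inp g′ ≔ x ⟫ ∎)
  where
  open ≡-Reasoning
  x = var (inp g)
  N = out g′ ⟦ inp g′ ≔ x ⟧

identityˡ : ∀ {A B} {f : SynHom A B} → (idSyn ∘Syn f) ≈Syn f
identityˡ {B = B} {f = f} = ≈-by-conf (idSyn ∘Syn f) f refl
  (cong₂ (λ l t → map p l ++ m t B ∷ []) (++-identityʳ (ctl f)) (subst-var 0 (out f)))

identityʳ : ∀ {A B} {f : SynHom A B} → (f ∘Syn idSyn) ≈Syn f
identityʳ {f = f} = eq-refl≡ (der (f ∘Syn idSyn)) (sym (conf-subst f (inp f) (var 0)))

assoc : ∀ {A B D E} {f : SynHom A B} {g : SynHom B D} {h : SynHom D E} →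
        ((h ∘Syn g) ∘Syn f) ≈Syn (h ∘Syn (g ∘Syn f))
assoc {f = f} {g} {h} = ≈-by-conf ((h ∘Syn g) ∘Syn f) (h ∘Syn (g ∘Syn f)) refl (begin
  conf ((h ∘Syn g) ∘Syn f)
    ≡⟨ conf-∘ (h ∘Syn g) f ⟩
  map p (ctl f) ++ conf (h ∘Syn g) ⟪ inp g ≔ out f ⟫
    ≡⟨ cong (map p (ctl f) ++_) (conf-∘-subst h g (out f)) ⟩
  map p (ctl f) ++ map p (subs (inp g) (out f) (ctl g)) ++ conf h ⟪ inp h ≔ out (g ∘Syn f) ⟫
    ≡⟨ sym (++-assoc (map p (ctl f)) _ _) ⟩
  (map p (ctl f) ++ map p (subs (inp g) (out f) (ctl g))) ++ conf h ⟪ inp h ≔ out (g ∘Syn f) ⟫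
    ≡⟨ cong (_++ conf h ⟪ inp h ≔ out (g ∘Syn f) ⟫) (sym (map-++ p (ctl f) _)) ⟩
  map p (ctl (g ∘Syn f)) ++ conf h ⟪ inp h ≔ out (g ∘Syn f) ⟫
    ≡⟨ sym (conf-∘ h (g ∘Syn f)) ⟩
  conf (h ∘Syn (g ∘Syn f)) ∎)
  where open ≡-Reasoning

syn-isCategory : IsCategory Syn
syn-isCategory = record
  { ≈-equiv   = ≈-equiv
  ; ∘-resp    = λ {A} {B} {D} {f} {f′} {g} {g′} → ∘-resp f f′ g g′
  ; identityˡ = λ {A} {B} {f} → identityˡ {f = f}
  ; identityʳ = λ {A} {B} {f} → identityʳ {f = f}
  ; assoc     = λ {A} {B} {D} {E} {f} {g} {h} → assoc {f = f} {g} {h}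
  }

-- Permutations used to bring the part of a configuration being worked on to
-- the end.
rotate : ∀ (κ a b : Conf) → (κ ++ a) ++ b ↭ (κ ++ b) ++ a
rotate κ a b = ↭-trans (↭-reflexive (++-assoc κ a b))
                       (↭-trans (++⁺ˡ κ (++-comm a b)) (↭-reflexive (sym (++-assoc κ b a))))

rotate-into : ∀ (κ a b : Conf) → (κ ++ a) ++ b ↭ κ ++ b ++ a
rotate-into κ a b = ↭-trans (↭-reflexive (++-assoc κ a b)) (++⁺ˡ κ (++-comm a b))

der-reassoc : ∀ {x E} κ {a b} → Der x E (κ ++ a ++ b) → Der x E ((κ ++ a) ++ b)
der-reassoc κ d = der-cast d (sym (++-assoc κ _ _))

eq-reassoc : ∀ {x E} κ κ′ {a b a′ b′} → Eq x E ((κ ++ a) ++ b) ((κ′ ++ a′) ++ b′) →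
             Eq x E (κ ++ a ++ b) (κ′ ++ a′ ++ b′)
eq-reassoc κ κ′ e = eq-cast e (++-assoc κ _ _) (++-assoc κ′ _ _)

infixr 6 _⊛_ _⊛T_ _⊛M_

data Shape : Fm → Set where
  leaf : ∀ A → Shape A
  _⊛_  : ∀ {A B} → Shape A → Shape B → Shape (A ⅋ B)

variable
  𝔞 𝔟 𝔠 𝔞′ 𝔟′ : Fm
  s : Shape 𝔞
  t : Shape 𝔟
  u : Shape 𝔠
  s′ : Shape 𝔞′
  t′ : Shape 𝔟′

fm : ∀ {A} → Shape A → Fm
fm {A} _ = A

data Tuple : ∀ {A} → Shape A → Set where
  leafT : ∀ {A} → Tm → Tuple (leaf A)
  _⊛T_  : Tuple s → Tuple t → Tuple (s ⊛ t)

build : Tuple t → Tm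
build (leafT M) = M
build (X ⊛T Y)  = build X ⅋ₜ build Y

entries : Tuple t → Conf
entries (leafT {A} M) = m M A ∷ []
entries (X ⊛T Y)      = entries X ++ entries Y

project : ∀ {A} (t : Shape A) → Tm → Tuple t
project (leaf A) M = leafT M
project (s ⊛ t) M  = project s (casel M) ⊛T project t (caser M)

data MorTree : ∀ {A B} → Shape A → Shape B → Set where
  leafM : ∀ {A B} → SynHom A B → MorTree (leaf A) (leaf B)
  _⊛M_  : MorTree s t → MorTree s′ t′ → MorTree (s ⊛ s′) (t ⊛ t′)

applyConf : MorTree s t → Tuple s → Conf
applyConf (leafM f) (leafT M) = conf f ⟪ inp f ≔ M ⟫
applyConf (F ⊛M G) (X ⊛T Y)   = applyConf F X ++ applyConf G Y

applyCtl : MorTree s t → Tuple s → List Tm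
applyCtl (leafM f) (leafT M) = subs (inp f) M (ctl f)
applyCtl (F ⊛M G) (X ⊛T Y)   = applyCtl F X ++ applyCtl G Y

applyOut : MorTree s t → Tuple s → Tuple t
applyOut (leafM f) (leafT M) = leafT (out f ⟦ inp f ≔ M ⟧)
applyOut (F ⊛M G) (X ⊛T Y)   = applyOut F X ⊛T applyOut G Y

applyConf-split : ∀ (F : MorTree s t) X → applyConf F X ↭ map p (applyCtl F X) ++ entries (applyOut F X)
applyConf-split (leafM f) (leafT M) = ↭-reflexive (conf-subst f (inp f) M)
applyConf-split (F ⊛M G) (X ⊛T Y) =
  ↭-trans (++⁺-↭ (applyConf-split F X) (applyConf-split G Y))
  (↭-trans (↭-reflexive (++-assoc cF oF _))
  (↭-trans (++⁺ˡ cF (shifts oF cG))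
           (↭-reflexive (trans (sym (++-assoc cF cG _))
                               (cong (_++ oF ++ entries (applyOut G Y)) (sym (map-++ p (applyCtl F X) _)))))))
  where
  cF = map p (applyCtl F X)
  cG = map p (applyCtl G Y)
  oF = entries (applyOut F X)

idTree : ∀ {A} (s : Shape A) → MorTree s s
idTree (leaf A) = leafM idSyn
idTree (s ⊛ t)  = idTree s ⊛M idTree t

applyConf-id : ∀ (X : Tuple s) → applyConf (idTree s) X ≡ entries X
applyConf-id (leafT M) = refl
applyConf-id (X ⊛T Y)  = cong₂ _++_ (applyConf-id X) (applyConf-id Y)

applyConf-project-subst : ∀ (F : MorTree s t) N y M →
  applyConf F (project s N) ⟪ y ≔ M ⟫ ≡ applyConf F (project s (N ⟦ y ≔ M ⟧))
applyConf-project-subst (leafM f) N y M = csubst-compose (conf f) (inp f) N y M (closed f)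
applyConf-project-subst (F ⊛M G) N y M =
  trans (csubst-++ (applyConf F (project _ (casel N))) _ y M)
        (cong₂ _++_ (applyConf-project-subst F (casel N) y M) (applyConf-project-subst G (caser N) y M))

applyCtl-project-subst : ∀ (F : MorTree s t) N y M →
  subs y M (applyCtl F (project s N)) ≡ applyCtl F (project s (N ⟦ y ≔ M ⟧))
applyCtl-project-subst (leafM f) N y M = subs-compose (ctl f) (inp f) N y M (ctl-closed f)
applyCtl-project-subst (F ⊛M G) N y M =
  trans (map-++ _ (applyCtl F (project _ (casel N))) _)
        (cong₂ _++_ (applyCtl-project-subst F (casel N) y M) (applyCtl-project-subst G (caser N) y M))

applyOut-project-subst : ∀ (F : MorTree s t) N y M →
  build (applyOut F (project s N)) ⟦ y ≔ M ⟧ ≡ build (applyOut F (project s (N ⟦ y ≔ M ⟧)))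
applyOut-project-subst (leafM f) N y M = subst-compose (out f) (inp f) N y M (out-closed f)
applyOut-project-subst (F ⊛M G) N y M =
  cong₂ _⅋ₜ_ (applyOut-project-subst F (casel N) y M) (applyOut-project-subst G (caser N) y M)

der-applyVar : ∀ (F : MorTree s t) y → Der y (fm s) (applyConf F (project s (var y)))
der-applyVar (leafM f) y = der-rename y (der f)
der-applyVar (F ⊛M G) y = der-cast (⅋-elim {κ = []} ax (der-applyVar F y) (der-applyVar G y))
  (cong₂ _++_ (projection-var F casel) (projection-var G caser))
  where
  projection-var : ∀ {𝔞 𝔟} {s : Shape 𝔞} {t : Shape 𝔟} (H : MorTree s t) (π : Tm → Tm) →
    applyConf H (project s (var y)) ⟪ y ≔ π (var y) ⟫ ≡ applyConf H (project s (π (var y)))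
  projection-var H π = trans (applyConf-project-subst H (var y) y (π (var y)))
                             (cong (λ z → applyConf H (project _ z)) (subst-var y (π (var y))))

der-projVar : ∀ {A} (t : Shape A) y → Der y (fm t) (entries (project t (var y)))
der-projVar t y = der-cast (der-applyVar (idTree t) y) (applyConf-id (project t (var y)))

der-applyCut : ∀ {x E} κ (F : MorTree s t) M → Der x E (κ ++ m M (fm s) ∷ []) →
               Der x E (κ ++ applyConf F (project s M))
der-applyCut κ F M d = der-cast (der-cutLast d (der-applyVar F 0))
                                (cong (κ ++_) (applyConf-project-subst F (var 0) 0 M))

der-project : ∀ {x E A} κ (t : Shape A) M → Der x E (κ ++ m M (fm t) ∷ []) → Der x E (κ ++ entries (project t M))
der-project κ t M d = der-cast (der-applyCut κ (idTree t) M d) (cong (κ ++_) (applyConf-id (project t M)))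

der-apply : ∀ {x E} κ (F : MorTree s t) (L : Tuple s) → Der x E (κ ++ entries L) → Der x E (κ ++ applyConf F L)
der-apply κ (leafM f) (leafT M) d = der-cutLast d (der f)
der-apply κ (F ⊛M G) (X ⊛T Y) d =
  let dG = der-apply (κ ++ entries X) G Y (der-reassoc κ d)
      dF = der-apply (κ ++ applyConf G Y) F X (exch dG (rotate κ (entries X) _))
  in exch dF (rotate-into κ _ _)

mutual
  der-build : ∀ {x E} κ (L : Tuple t) → Der x E (κ ++ entries L) → Der x E (κ ++ m (build L) (fm t) ∷ [])
  der-build κ (leafT M) d = d
  der-build κ (X ⊛T Y) d  = ⅋-intro {κ = κ} (der-build₂ κ X Y d)

  der-build₂ : ∀ {x E} κ (X : Tuple s) (Y : Tuple t) → Der x E (κ ++ entries X ++ entries Y) →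
               Der x E (κ ++ m (build X) (fm s) ∷ m (build Y) (fm t) ∷ [])
  der-build₂ κ X Y d =
    let dY = der-build (κ ++ entries X) Y (der-reassoc κ d)
        dX = der-build (κ ++ _) X (exch dY (rotate κ (entries X) _))
    in exch dX (rotate-into κ _ _)

der-reproject : ∀ {x E A} κ (t : Shape A) N → Der x E (κ ++ m N (fm t) ∷ []) →
                Der x E (κ ++ m (build (project t N)) (fm t) ∷ [])
der-reproject κ t N d = der-build κ (project t N) (der-project κ t N d)

mutual
  cong-build : ∀ {x E} κ κ′ (L L′ : Tuple t) → Eq x E (κ ++ entries L) (κ′ ++ entries L′) →
               Eq x E (κ ++ m (build L) (fm t) ∷ []) (κ′ ++ m (build L′) (fm t) ∷ [])
  cong-build κ κ′ (leafT M) (leafT M′) e = e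
  cong-build κ κ′ (X ⊛T Y) (X′ ⊛T Y′) e = cong-⅋-intro {κ = κ} {κ′} (cong-build₂ κ κ′ X X′ Y Y′ e)

  cong-build₂ : ∀ {x E} κ κ′ (X X′ : Tuple s) (Y Y′ : Tuple t) →
                Eq x E (κ ++ entries X ++ entries Y) (κ′ ++ entries X′ ++ entries Y′) →
                Eq x E (κ ++ m (build X) (fm s) ∷ m (build Y) (fm t) ∷ [])
                       (κ′ ++ m (build X′) (fm s) ∷ m (build Y′) (fm t) ∷ [])
  cong-build₂ κ κ′ X X′ Y Y′ e =
    let eY = cong-build (κ ++ entries X) (κ′ ++ entries X′) Y Y′
                        (eq-cast e (sym (++-assoc κ _ _)) (sym (++-assoc κ′ _ _)))
        eX = cong-build (κ ++ _) (κ′ ++ _) X X′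
                        (eq-exch eY (rotate κ (entries X) _) (rotate κ′ (entries X′) _))
    in eq-exch eX (rotate-into κ _ _) (rotate-into κ′ _ _)

apply-β : ∀ {x E} κ (F : MorTree s t) (L : Tuple s) → Der x E (κ ++ entries L) →
          Eq x E (κ ++ applyConf F (project s (build L))) (κ ++ applyConf F L)
apply-β κ (leafM f) (leafT M) d = eq-refl (der-apply κ (leafM f) (leafT M) d)
apply-β {s = s₁ ⊛ s₂} κ (F ⊛M G) (X ⊛T Y) d = ⅋β ⨾ eq-reassoc κ κ stepF ⨾ eq-reassoc κ κ stepG
  where
  bX = build X
  bY = build Y
  ⅋β = eq-cast (⅋-β {κ = κ} {M₀ = bX} {M₁ = bY} (der-build₂ κ X Y d) (der-applyVar F 0) (der-applyVar G 0))
    (cong (κ ++_) (cong₂ _++_ (applyConf-project-subst F (var 0) 0 (casel (bX ⅋ₜ bY)))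
                              (applyConf-project-subst G (var 0) 0 (caser (bX ⅋ₜ bY)))))
    (cong (κ ++_) (cong₂ _++_ (applyConf-project-subst F (var 0) 0 bX)
                              (applyConf-project-subst G (var 0) 0 bY)))
  appG = applyConf G (project s₂ bY)
  dG = der-applyCut (κ ++ entries X) G bY (der-build (κ ++ entries X) Y (der-reassoc κ d))
  stepF = eq-exch (apply-β (κ ++ appG) F X (exch dG (rotate κ (entries X) appG)))
                  (rotate κ appG _) (rotate κ appG _)
  dF = der-apply (κ ++ entries Y) F X (exch (der-reassoc κ d) (rotate κ (entries X) (entries Y)))
  stepG = apply-β (κ ++ applyConf F X) G Y (exch dF (rotate κ (entries Y) _))

tuple-β : ∀ {x E} κ (L : Tuple s) → Der x E (κ ++ entries L) → Eq x E (κ ++ entries (project s (build L))) (κ ++ entries L)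
tuple-β {s = s} κ L d = eq-cast (apply-β κ (idTree s) L d)
  (cong (κ ++_) (applyConf-id (project s (build L)))) (cong (κ ++_) (applyConf-id L))

tuple-η : ∀ {x E A} κ (t : Shape A) M → Der x E (κ ++ m M (fm t) ∷ []) →
          Eq x E (κ ++ m (build (project t M)) (fm t) ∷ []) (κ ++ m M (fm t) ∷ [])
tuple-η κ (leaf A) M d = eq-refl d
tuple-η κ (s ⊛ t) M d =
  cong-⅋-intro {κ = κ} {κ} (eq-reassoc κ κ (eq-exch ηs (rotate κ bt _) (rotate κ bt l) ⨾ ηt)) ⨾ ⅋-η {κ = κ} d
  where
  l = m (casel M) (fm s) ∷ []
  bt = m (build (project t (caser M))) (fm t) ∷ []
  dl = der-reassoc κ (⅋-elim {κ = κ} d (ax {x = 0}) (ax {x = 0}))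
  ηt = tuple-η (κ ++ l) t (caser M) dl
  ηs = tuple-η (κ ++ bt) s (casel M) (exch (der-reproject (κ ++ l) t (caser M) dl) (rotate κ l bt))

projVar : ∀ {A} (s : Shape A) → Tuple s
projVar s = project s (var 0)

der-tensor : ∀ (F : MorTree s t) → Der 0 (fm s) (map p (applyCtl F (projVar s)) ++ entries (applyOut F (projVar s)))
der-tensor {s = s} F = exch (der-applyVar F 0) (applyConf-split F (projVar s))

tensorHom : MorTree s t → SynHom (fm s) (fm t)
tensorHom {s = s} F = mor 0 (applyCtl F (projVar s)) (build (applyOut F (projVar s)))
  (der-build (map p (applyCtl F (projVar s))) (applyOut F (projVar s)) (der-tensor F))

tensorHom-subst : ∀ (F : MorTree s t) N → conf (tensorHom F) ⟪ 0 ≔ N ⟫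
  ≡ map p (applyCtl F (project s N)) ++ m (build (applyOut F (project s N))) (fm t) ∷ []
tensorHom-subst {t = t} F N = trans (conf-subst (tensorHom F) 0 N)
  (cong₂ (λ a b → map p a ++ m b (fm t) ∷ [])
         (applyCtl-project-subst F (var 0) 0 N) (applyOut-project-subst F (var 0) 0 N))

tensor-after-build : ∀ {x E} κ (F : MorTree s t) (L : Tuple s) → Der x E (κ ++ entries L) →
  Eq x E (κ ++ map p (applyCtl F (project s (build L))) ++ m (build (applyOut F (project s (build L)))) (fm t) ∷ [])
         (κ ++ map p (applyCtl F L) ++ m (build (applyOut F L)) (fm t) ∷ [])
tensor-after-build {s = s} κ F L d = eq-reassoc κ κ
  (cong-build (κ ++ map p (applyCtl F X)) (κ ++ map p (applyCtl F L)) (applyOut F X) (applyOut F L)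
    (eq-cast (eq-exch (apply-β κ F L d) (++⁺ˡ κ (applyConf-split F X)) (++⁺ˡ κ (applyConf-split F L)))
             (sym (++-assoc κ _ _)) (sym (++-assoc κ _ _))))
  where
  X = project s (build L)

mapTuple : (Tm → Tm) → Tuple s → Tuple s
mapTuple φ (leafT M) = leafT (φ M)
mapTuple φ (X ⊛T Y)  = mapTuple φ X ⊛T mapTuple φ Y

build-mapTuple : ∀ (X : Tuple s) y N → build (mapTuple (_⟦ y ≔ N ⟧) X) ≡ build X ⟦ y ≔ N ⟧
build-mapTuple (leafT M) y N = refl
build-mapTuple (X ⊛T Y) y N  = cong₂ _⅋ₜ_ (build-mapTuple X y N) (build-mapTuple Y y N)

project-mapTuple : ∀ {A} (s : Shape A) M y N → mapTuple (_⟦ y ≔ N ⟧) (project s M) ≡ project s (M ⟦ y ≔ N ⟧)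
project-mapTuple (leaf A) M y N = refl
project-mapTuple (s ⊛ t) M y N  =
  cong₂ _⊛T_ (project-mapTuple s (casel M) y N) (project-mapTuple t (caser M) y N)

record Rearrangement {A B} (s : Shape A) (t : Shape B) : Set where
  field
    move         : Tuple s → Tuple t
    move-↭       : ∀ X → entries X ↭ entries (move X)
    move-natural : ∀ φ X → move (mapTuple φ X) ≡ mapTuple φ (move X)
open Rearrangement public

_∘R_ : Rearrangement t u → Rearrangement s t → Rearrangement s u
q ∘R r = record
  { move         = λ X → move q (move r X)
  ; move-↭       = λ X → ↭-trans (move-↭ r X) (move-↭ q (move r X))
  ; move-natural = λ φ X → trans (cong (move q) (move-natural r φ X)) (move-natural q φ (move r X))
  }

wiring : Rearrangement s t → SynHom (fm s) (fm t)
wiring {s = s} r = mor 0 [] (build (move r (projVar s)))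
  (der-build [] (move r (projVar s)) (exch (der-projVar s 0) (move-↭ r (projVar s))))

wiring-subst : ∀ (r : Rearrangement s t) N → build (move r (projVar s)) ⟦ 0 ≔ N ⟧ ≡ build (move r (project s N))
wiring-subst {s = s} r N = trans (sym (build-mapTuple (move r (projVar s)) 0 N))
  (cong build (trans (sym (move-natural r _ (projVar s))) (cong (move r) (project-mapTuple s (var 0) 0 N))))

wiring-after-build : ∀ {x E} κ (r : Rearrangement s t) (L : Tuple s) → Der x E (κ ++ entries L) →
  Eq x E (κ ++ m (build (move r (project s (build L)))) (fm t) ∷ []) (κ ++ m (build (move r L)) (fm t) ∷ [])
wiring-after-build {s = s} κ r L d = cong-build κ κ (move r (project s (build L))) (move r L)
  (eq-exch (tuple-β κ L d) (++⁺ˡ κ (move-↭ r _)) (++⁺ˡ κ (move-↭ r L)))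

wiring-∘ : ∀ (r₁ : Rearrangement s t) (r₂ : Rearrangement t u) → (wiring r₂ ∘Syn wiring r₁) ≈Syn wiring (r₂ ∘R r₁)
wiring-∘ {s = s} {u = u} r₁ r₂ = ≈-by-eq (wiring r₂ ∘Syn wiring r₁) (wiring (r₂ ∘R r₁)) refl
  (eq-cast (wiring-after-build [] r₂ (move r₁ (projVar s)) (exch (der-projVar s 0) (move-↭ r₁ (projVar s))))
           (cong (λ z → m z (fm u) ∷ []) (sym (wiring-subst r₂ (build (move r₁ (projVar s)))))) refl)

wiring-id : ∀ (r : Rearrangement s s) → move r (projVar s) ≡ projVar s → wiring r ≈Syn idSyn
wiring-id {s = s} r eq = ≈-by-eq (wiring r) idSyn refl
  (eq-cast (tuple-η [] s (var 0) ax) (cong (λ z → m (build z) (fm s) ∷ []) (sym eq)) refl)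

wiring-≡ : ∀ (r r′ : Rearrangement s t) → move r (projVar s) ≡ move r′ (projVar s) → wiring r ≈Syn wiring r′
wiring-≡ {t = t} r r′ eq = ≈-by-conf (wiring r) (wiring r′) refl (cong (λ z → m (build z) (fm t) ∷ []) eq)

reassoc : ∀ {A B D} {a : Shape A} {b : Shape B} {d : Shape D} → Rearrangement ((a ⊛ b) ⊛ d) (a ⊛ (b ⊛ d))
reassoc = record { move = mv ; move-↭ = mv-↭ ; move-natural = mv-natural }
  where
  mv : _ → _
  mv ((X ⊛T Y) ⊛T Z) = X ⊛T (Y ⊛T Z)
  mv-↭ : ∀ X → entries X ↭ entries (mv X)
  mv-↭ ((X ⊛T Y) ⊛T Z) = ↭-reflexive (++-assoc (entries X) (entries Y) (entries Z))
  mv-natural : ∀ φ X → mv (mapTuple φ X) ≡ mapTuple φ (mv X)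
  mv-natural φ ((X ⊛T Y) ⊛T Z) = refl

reassoc⁻¹ : ∀ {A B D} {a : Shape A} {b : Shape B} {d : Shape D} → Rearrangement (a ⊛ (b ⊛ d)) ((a ⊛ b) ⊛ d)
reassoc⁻¹ = record { move = mv ; move-↭ = mv-↭ ; move-natural = mv-natural }
  where
  mv : _ → _
  mv (X ⊛T (Y ⊛T Z)) = (X ⊛T Y) ⊛T Z
  mv-↭ : ∀ X → entries X ↭ entries (mv X)
  mv-↭ (X ⊛T (Y ⊛T Z)) = ↭-reflexive (sym (++-assoc (entries X) (entries Y) (entries Z)))
  mv-natural : ∀ φ X → mv (mapTuple φ X) ≡ mapTuple φ (mv X)
  mv-natural φ (X ⊛T (Y ⊛T Z)) = refl

exchange : ∀ {A B} {a : Shape A} {b : Shape B} → Rearrangement (a ⊛ b) (b ⊛ a)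
exchange = record { move = mv ; move-↭ = mv-↭ ; move-natural = mv-natural }
  where
  mv : _ → _
  mv (X ⊛T Y) = Y ⊛T X
  mv-↭ : ∀ X → entries X ↭ entries (mv X)
  mv-↭ (X ⊛T Y) = ++-comm (entries X) (entries Y)
  mv-natural : ∀ φ X → mv (mapTuple φ X) ≡ mapTuple φ (mv X)
  mv-natural φ (X ⊛T Y) = refl

stay : ∀ {A} {a : Shape A} → Rearrangement a a
stay = record { move = λ X → X ; move-↭ = λ X → ↭-refl ; move-natural = λ φ X → refl }

_⊛R_ : ∀ {A B D E} {a : Shape A} {b : Shape B} {d : Shape D} {e : Shape E} →
       Rearrangement a b → Rearrangement d e → Rearrangement (a ⊛ d) (b ⊛ e)
r ⊛R q = record { move = mv ; move-↭ = mv-↭ ; move-natural = mv-natural }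
  where
  mv : _ → _
  mv (X ⊛T Y) = move r X ⊛T move q Y
  mv-↭ : ∀ X → entries X ↭ entries (mv X)
  mv-↭ (X ⊛T Y) = ++⁺-↭ (move-↭ r X) (move-↭ q Y)
  mv-natural : ∀ φ X → mv (mapTuple φ X) ≡ mapTuple φ (mv X)
  mv-natural φ (X ⊛T Y) = cong₂ _⊛T_ (move-natural r φ X) (move-natural q φ Y)

expand : (A : Fm) → Shape A
expand (A ⅋ B) = expand A ⊛ expand B
expand (gnd n) = leaf (gnd n)
expand ⊥ᶠ      = leaf ⊥ᶠ
expand (A ∖ B) = leaf (A ∖ B)

expandTuple : Tuple t → Tuple t
expandTuple (leafT {B} M) = leafT (build (project (expand B) M))
expandTuple (X ⊛T Y)      = expandTuple X ⊛T expandTuple Y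

der-expandTuple : ∀ {x E} κ (L : Tuple t) → Der x E (κ ++ entries L) → Der x E (κ ++ entries (expandTuple L))
der-expandTuple κ (leafT {B} M) d = der-reproject κ (expand B) M d
der-expandTuple κ (X ⊛T Y) d =
  let dY = der-expandTuple (κ ++ entries X) Y (der-reassoc κ d)
      dX = der-expandTuple (κ ++ entries (expandTuple Y)) X (exch dY (rotate κ (entries X) _))
  in exch dX (rotate-into κ _ _)

expandTuple-η : ∀ {x E} κ (L : Tuple t) → Der x E (κ ++ entries L) → Eq x E (κ ++ entries L) (κ ++ entries (expandTuple L))
expandTuple-η κ (leafT {B} M) d = eq-sym (tuple-η κ (expand B) M d)
expandTuple-η κ (X ⊛T Y) d = eq-reassoc κ κ (eq-exch ηX (rotate κ (entries Y) _) (rotate κ (entries Y) _) ⨾ ηY)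
  where
  dYX = exch (der-reassoc κ d) (rotate κ (entries X) (entries Y))
  ηX = expandTuple-η (κ ++ entries Y) X dYX
  ηY = expandTuple-η (κ ++ entries (expandTuple X)) Y
         (exch (der-expandTuple (κ ++ entries Y) X dYX) (rotate κ (entries Y) _))

wiring-expand : ∀ (r : Rearrangement s t) →
  Eq 0 (fm s) (m (build (move r (projVar s))) (fm t) ∷ []) (m (build (move r (expandTuple (projVar s)))) (fm t) ∷ [])
wiring-expand {s = s} r = cong-build [] [] (move r (projVar s)) (move r (expandTuple (projVar s)))
  (eq-exch (expandTuple-η [] (projVar s) (der-projVar s 0)) (move-↭ r (projVar s)) (move-↭ r (expandTuple (projVar s))))

_⊗₁_ : ∀ {A B A′ B′} → SynHom A A′ → SynHom B B′ → SynHom (A ⅋ B) (A′ ⅋ B′)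
f ⊗₁ g = tensorHom (leafM f ⊛M leafM g)

tensor-cong : ∀ (F F′ : MorTree s t) → Eq 0 (fm s) (applyConf F (projVar s)) (applyConf F′ (projVar s)) →
              tensorHom F ≈Syn tensorHom F′
tensor-cong {s = s} F F′ e = ≈-by-eq (tensorHom F) (tensorHom F′) refl
  (cong-build (map p (applyCtl F (projVar s))) (map p (applyCtl F′ (projVar s)))
              (applyOut F (projVar s)) (applyOut F′ (projVar s))
              (eq-exch e (applyConf-split F (projVar s)) (applyConf-split F′ (projVar s))))

⊗-resp : ∀ {A B A′ B′} (f f′ : SynHom A A′) (g g′ : SynHom B B′) →
         f ≈Syn f′ → g ≈Syn g′ → (f ⊗₁ g) ≈Syn (f′ ⊗₁ g′)
⊗-resp f f′ g g′ ef eg = tensor-cong (leafM f ⊛M leafM g) (leafM f′ ⊛M leafM g′)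
  (eq-cast (cong-⅋-elim {κ = []} {κ′ = []} (eq-refl ax) ef eg) refl
           (cong₂ _++_ (rename-subst f′ (inp f) (casel (var 0))) (rename-subst g′ (inp g) (caser (var 0)))))

⊗-id : ∀ {A B} → (idSyn {A} ⊗₁ idSyn {B}) ≈Syn idSyn
⊗-id {A} {B} = ≈-by-eq (idSyn ⊗₁ idSyn) idSyn refl (tuple-η [] (leaf A ⊛ leaf B) (var 0) ax)

interchange : ∀ (a b c d e : Conf) → ((a ++ b) ++ (c ++ d)) ++ e ↭ (a ++ c) ++ ((b ++ d) ++ e)
interchange a b c d e =
  ↭-trans (↭-reflexive (trans (++-assoc (a ++ b) _ e) (trans (++-assoc a b _) (cong (λ z → a ++ b ++ z) (++-assoc c d e)))))
  (↭-trans (++⁺ˡ a (shifts b c))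
           (↭-reflexive (trans (cong (λ z → a ++ c ++ z) (sym (++-assoc b d e))) (sym (++-assoc a c _)))))

-- Functoriality of ⊗: the composite (f′ ⊗ g′) ∘ (f ⊗ g) reduces by the tuple
-- β-law to the tree (f′ ∘ f , g′ ∘ g), up to the order of the control area.
⊗-∘ : ∀ {A B A′ B′ A″ B″} {f : SynHom A A′} {f′ : SynHom A′ A″} {g : SynHom B B′} {g′ : SynHom B′ B″} →
      ((f′ ∘Syn f) ⊗₁ (g′ ∘Syn g)) ≈Syn ((f′ ⊗₁ g′) ∘Syn (f ⊗₁ g))
⊗-∘ {A} {B} {A′} {B′} {A″} {B″} {f} {f′} {g} {g′} =
  ≈-by-eq ((f′ ∘Syn f) ⊗₁ (g′ ∘Syn g)) ((f′ ⊗₁ g′) ∘Syn (f ⊗₁ g)) refl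
    (eq-sym (eq-cast (eq-exch reduce ↭-refl (↭-sym regroup)) composite-conf product-conf))
  where
  F  = leafM f ⊛M leafM g
  F′ = leafM f′ ⊛M leafM g′
  O  = applyOut F (projVar (leaf A ⊛ leaf B))
  a  = subs (inp f) (casel (var 0)) (ctl f)
  b  = subs (inp g) (caser (var 0)) (ctl g)
  a′ = subs (inp f′) (out f ⟦ inp f ≔ casel (var 0) ⟧) (ctl f′)
  b′ = subs (inp g′) (out g ⟦ inp g ≔ caser (var 0) ⟧) (ctl g′)
  o  = m ((out f′ ⟦ inp f′ ≔ out f ⟦ inp f ≔ casel (var 0) ⟧ ⟧) ⅋ₜ (out g′ ⟦ inp g′ ≔ out g ⟦ inp g ≔ caser (var 0) ⟧ ⟧))
         (A″ ⅋ B″) ∷ []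
  reduce = tensor-after-build (map p (a ++ b)) F′ O (der-tensor F)
  composite-conf : map p (a ++ b) ++ map p (applyCtl F′ (project (leaf A′ ⊛ leaf B′) (build O)))
                     ++ m (build (applyOut F′ (project (leaf A′ ⊛ leaf B′) (build O)))) (A″ ⅋ B″) ∷ []
                   ≡ conf ((f′ ⊗₁ g′) ∘Syn (f ⊗₁ g))
  composite-conf = sym (trans (conf-∘ (f′ ⊗₁ g′) (f ⊗₁ g)) (cong (map p (a ++ b) ++_) (tensorHom-subst F′ (build O))))
  regroup : map p ((a ++ a′) ++ (b ++ b′)) ++ o ↭ map p (a ++ b) ++ map p (a′ ++ b′) ++ o
  regroup =
    ↭-trans (↭-reflexive (cong (_++ o) (trans (map-++ p (a ++ a′) _) (cong₂ _++_ (map-++ p a a′) (map-++ p b b′)))))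
    (↭-trans (interchange (map p a) (map p a′) (map p b) (map p b′) o)
             (↭-reflexive (trans (cong (_++ (map p a′ ++ map p b′) ++ o) (sym (map-++ p a b)))
                                 (cong (λ z → map p (a ++ b) ++ z ++ o) (sym (map-++ p a′ b′))))))
  product-conf : map p ((a ++ a′) ++ (b ++ b′)) ++ o ≡ conf ((f′ ∘Syn f) ⊗₁ (g′ ∘Syn g))
  product-conf = sym (cong₂ (λ u v → map p u ++ v)
    (cong₂ _++_ (trans (map-++ _ (ctl f) _) (cong (a ++_) (subs-compose (ctl f′) (inp f′) (out f) (inp f) _ (ctl-closed f′))))
                (trans (map-++ _ (ctl g) _) (cong (b ++_) (subs-compose (ctl g′) (inp g′) (out g) (inp g) _ (ctl-closed g′)))))
    (cong (λ z → m z (A″ ⅋ B″) ∷ [])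
      (cong₂ _⅋ₜ_ (subst-compose (out f′) (inp f′) (out f) (inp f) _ (out-closed f′))
                  (subst-compose (out g′) (inp g′) (out g) (inp g) _ (out-closed g′)))))

α⇒ : ∀ {A B D} → SynHom ((A ⅋ B) ⅋ D) (A ⅋ (B ⅋ D))
α⇒ {A} {B} {D} = wiring {s = (leaf A ⊛ leaf B) ⊛ leaf D} reassoc

α⇐ : ∀ {A B D} → SynHom (A ⅋ (B ⅋ D)) ((A ⅋ B) ⅋ D)
α⇐ {A} {B} {D} = wiring {s = leaf A ⊛ (leaf B ⊛ leaf D)} reassoc⁻¹

σ : ∀ {A B} → SynHom (A ⅋ B) (B ⅋ A)
σ {A} {B} = wiring {s = leaf A ⊛ leaf B} exchange

wiring-inverse : ∀ (r₁ : Rearrangement s t) (r₂ : Rearrangement t s) → move r₂ (move r₁ (projVar s)) ≡ projVar s →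
                 (wiring r₂ ∘Syn wiring r₁) ≈Syn idSyn
wiring-inverse r₁ r₂ eq = ≈-trans {f = wiring r₂ ∘Syn wiring r₁} {g = wiring (r₂ ∘R r₁)} {h = idSyn}
                                  (wiring-∘ r₁ r₂) (wiring-id (r₂ ∘R r₁) eq)

α-isoˡ : ∀ {A B D} → (α⇐ {A} {B} {D} ∘Syn α⇒) ≈Syn idSyn
α-isoˡ {A} {B} {D} = wiring-inverse (reassoc {a = leaf A} {b = leaf B} {d = leaf D}) reassoc⁻¹ refl

α-isoʳ : ∀ {A B D} → (α⇒ {A} {B} {D} ∘Syn α⇐) ≈Syn idSyn
α-isoʳ {A} {B} {D} = wiring-inverse (reassoc⁻¹ {a = leaf A} {b = leaf B} {d = leaf D}) reassoc refl

σ-involutive : ∀ {A B} → (σ {B} {A} ∘Syn σ {A} {B}) ≈Syn idSyn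
σ-involutive {A} {B} = wiring-inverse (exchange {a = leaf A} {b = leaf B}) exchange refl

αᵉ : ∀ A B D → SynHom ((A ⅋ B) ⅋ D) (A ⅋ (B ⅋ D))
αᵉ A B D = wiring (reassoc {a = expand A} {b = expand B} {d = expand D})

α≈αᵉ : ∀ {A B D} → α⇒ {A} {B} {D} ≈Syn αᵉ A B D
α≈αᵉ {A} {B} {D} = ≈-by-eq (α⇒ {A} {B} {D}) (αᵉ A B D) refl (wiring-expand (reassoc {a = leaf A} {b = leaf B} {d = leaf D}))

σᵉ : ∀ A B → SynHom (A ⅋ B) (B ⅋ A)
σᵉ A B = wiring (exchange {a = expand A} {b = expand B})

σ≈σᵉ : ∀ {A B} → σ {A} {B} ≈Syn σᵉ A B
σ≈σᵉ {A} {B} = ≈-by-eq (σ {A} {B}) (σᵉ A B) refl (wiring-expand (exchange {a = leaf A} {b = leaf B}))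

wiring⊗id : ∀ {A} (r : Rearrangement s t) → (wiring r ⊗₁ idSyn {A}) ≈Syn wiring (r ⊛R stay {a = expand A})
wiring⊗id {s = s} {t = t} {A = A} r = ≈-by-eq (wiring r ⊗₁ idSyn) (wiring (r ⊛R stay {a = expand A})) refl
  (eq-cast (cong-⅋-intro {κ = []} {κ′ = []} (eq-sym (tuple-η (m X (fm t) ∷ []) (expand A) (caser (var 0)) d))) refl
           (cong (λ z → m (z ⅋ₜ build (project (expand A) (caser (var 0)))) _ ∷ []) (wiring-subst r (casel (var 0)))))
  where
  X = build (move r (projVar s)) ⟦ 0 ≔ casel (var 0) ⟧
  d = ⅋-elim {κ = []} ax (der (wiring r)) (ax {x = 0})

id⊗wiring : ∀ {A} (r : Rearrangement s t) → (idSyn {A} ⊗₁ wiring r) ≈Syn wiring (stay {a = expand A} ⊛R r)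
id⊗wiring {s = s} {t = t} {A = A} r = ≈-by-eq (idSyn ⊗₁ wiring r) (wiring (stay {a = expand A} ⊛R r)) refl
  (eq-cast (cong-⅋-intro {κ = []} {κ′ = []} (eq-exch (eq-sym (tuple-η (m Y (fm t) ∷ []) (expand A) (casel (var 0)) d)) sw sw)) refl
           (cong (λ z → m (build (project (expand A) (casel (var 0))) ⅋ₜ z) _ ∷ []) (wiring-subst r (caser (var 0)))))
  where
  Y = build (move r (projVar s)) ⟦ 0 ≔ caser (var 0) ⟧
  sw : ∀ {a b : Entry} → b ∷ a ∷ [] ↭ a ∷ b ∷ []
  sw = swap _ _ ↭-refl
  d = exch (⅋-elim {κ = []} ax (ax {x = 0}) (der (wiring r))) sw

wiring-∘₃ : ∀ {𝔡} {v : Shape 𝔡} (r₁ : Rearrangement s t) (r₂ : Rearrangement t u) (r₃ : Rearrangement u v) →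
            (wiring r₃ ∘Syn (wiring r₂ ∘Syn wiring r₁)) ≈Syn wiring (r₃ ∘R (r₂ ∘R r₁))
wiring-∘₃ r₁ r₂ r₃ = begin
  wiring r₃ ∘Syn (wiring r₂ ∘Syn wiring r₁)
    ≈⟨ ∘-resp (wiring r₃) (wiring r₃) (wiring r₂ ∘Syn wiring r₁) (wiring (r₂ ∘R r₁))
              (≈-refl {f = wiring r₃}) (wiring-∘ r₁ r₂) ⟩
  wiring r₃ ∘Syn wiring (r₂ ∘R r₁)
    ≈⟨ wiring-∘ (r₂ ∘R r₁) r₃ ⟩
  wiring (r₃ ∘R (r₂ ∘R r₁)) ∎
  where open ≈-Reasoning

-- Coherence: both sides of the pentagon and of the hexagon are wirings of
-- the same rearrangement of the fully expanded shape.
pentagon : ∀ {A B D E} →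
           ((idSyn {A} ⊗₁ α⇒ {B} {D} {E}) ∘Syn (α⇒ ∘Syn (α⇒ ⊗₁ idSyn))) ≈Syn (α⇒ ∘Syn α⇒)
pentagon {A} {B} {D} {E} = begin
  (idSyn ⊗₁ α⇒) ∘Syn (α⇒ ∘Syn (α⇒ ⊗₁ idSyn))
    ≈⟨ ∘-resp (idSyn ⊗₁ α⇒) (wiring r₃) (α⇒ ∘Syn (α⇒ ⊗₁ idSyn)) (wiring r₂ ∘Syn wiring r₁) id⊗α
             (∘-resp α⇒ (wiring r₂) (α⇒ ⊗₁ idSyn) (wiring r₁) α≈αᵉ α⊗id) ⟩
  wiring r₃ ∘Syn (wiring r₂ ∘Syn wiring r₁)
    ≈⟨ wiring-∘₃ r₁ r₂ r₃ ⟩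
  wiring (r₃ ∘R (r₂ ∘R r₁))
    ≈⟨ wiring-≡ (r₃ ∘R (r₂ ∘R r₁)) (q₂ ∘R q₁) refl ⟩
  wiring (q₂ ∘R q₁)
    ≈⟨ wiring-∘ q₁ q₂ ⟨
  wiring q₂ ∘Syn wiring q₁
    ≈⟨ ∘-resp α⇒ (wiring q₂) α⇒ (wiring q₁) α≈αᵉ α≈αᵉ ⟨
  α⇒ ∘Syn α⇒ ∎
  where
  open ≈-Reasoning
  a = expand A ; b = expand B ; d = expand D ; e = expand E
  r₁ = reassoc {a = a} {b = b} {d = d} ⊛R stay {a = e}
  r₂ = reassoc {a = a} {b = b ⊛ d} {d = e}
  r₃ = stay {a = a} ⊛R reassoc {a = b} {b = d} {d = e}
  q₁ = reassoc {a = a ⊛ b} {b = d} {d = e}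
  q₂ = reassoc {a = a} {b = b} {d = d ⊛ e}
  α⊗id : (α⇒ {A} {B} {D} ⊗₁ idSyn {E}) ≈Syn wiring r₁
  α⊗id = begin
    α⇒ ⊗₁ idSyn      ≈⟨ ⊗-resp α⇒ (αᵉ A B D) idSyn idSyn α≈αᵉ (≈-refl {f = idSyn}) ⟩
    αᵉ A B D ⊗₁ idSyn ≈⟨ wiring⊗id (reassoc {a = a} {b = b} {d = d}) ⟩
    wiring r₁        ∎
  id⊗α : (idSyn {A} ⊗₁ α⇒ {B} {D} {E}) ≈Syn wiring r₃
  id⊗α = begin
    idSyn ⊗₁ α⇒      ≈⟨ ⊗-resp idSyn idSyn α⇒ (αᵉ B D E) (≈-refl {f = idSyn}) α≈αᵉ ⟩
    idSyn ⊗₁ αᵉ B D E ≈⟨ id⊗wiring (reassoc {a = b} {b = d} {d = e}) ⟩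
    wiring r₃        ∎

hexagon : ∀ {A B D} →
          (α⇒ {B} {D} {A} ∘Syn (σ {A} {B ⅋ D} ∘Syn α⇒)) ≈Syn ((idSyn ⊗₁ σ) ∘Syn (α⇒ ∘Syn (σ ⊗₁ idSyn)))
hexagon {A} {B} {D} = begin
  α⇒ ∘Syn (σ ∘Syn α⇒)
    ≈⟨ ∘-resp α⇒ (wiring x₃) (σ ∘Syn α⇒) (wiring x₂ ∘Syn wiring x₁) α≈αᵉ
              (∘-resp σ (wiring x₂) α⇒ (wiring x₁) σ≈σᵉ α≈αᵉ) ⟩
  wiring x₃ ∘Syn (wiring x₂ ∘Syn wiring x₁)
    ≈⟨ wiring-∘₃ x₁ x₂ x₃ ⟩
  wiring (x₃ ∘R (x₂ ∘R x₁))
    ≈⟨ wiring-≡ (x₃ ∘R (x₂ ∘R x₁)) (y₃ ∘R (y₂ ∘R y₁)) refl ⟩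
  wiring (y₃ ∘R (y₂ ∘R y₁))
    ≈⟨ wiring-∘₃ y₁ y₂ y₃ ⟨
  wiring y₃ ∘Syn (wiring y₂ ∘Syn wiring y₁)
    ≈⟨ ∘-resp (idSyn ⊗₁ σ) (wiring y₃) (α⇒ ∘Syn (σ ⊗₁ idSyn)) (wiring y₂ ∘Syn wiring y₁) id⊗σ
             (∘-resp α⇒ (wiring y₂) (σ ⊗₁ idSyn) (wiring y₁) α≈αᵉ σ⊗id) ⟨
  (idSyn ⊗₁ σ) ∘Syn (α⇒ ∘Syn (σ ⊗₁ idSyn)) ∎
  where
  open ≈-Reasoning
  a = expand A ; b = expand B ; d = expand D
  x₁ = reassoc {a = a} {b = b} {d = d}
  x₂ = exchange {a = a} {b = b ⊛ d}
  x₃ = reassoc {a = b} {b = d} {d = a}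
  y₁ = exchange {a = a} {b = b} ⊛R stay {a = d}
  y₂ = reassoc {a = b} {b = a} {d = d}
  y₃ = stay {a = b} ⊛R exchange {a = a} {b = d}
  σ⊗id : (σ {A} {B} ⊗₁ idSyn {D}) ≈Syn wiring y₁
  σ⊗id = begin
    σ ⊗₁ idSyn      ≈⟨ ⊗-resp σ (σᵉ A B) idSyn idSyn σ≈σᵉ (≈-refl {f = idSyn}) ⟩
    σᵉ A B ⊗₁ idSyn ≈⟨ wiring⊗id (exchange {a = a} {b = b}) ⟩
    wiring y₁       ∎
  id⊗σ : (idSyn {B} ⊗₁ σ {A} {D}) ≈Syn wiring y₃
  id⊗σ = begin
    idSyn ⊗₁ σ      ≈⟨ ⊗-resp idSyn idSyn σ (σᵉ A D) (≈-refl {f = idSyn}) σ≈σᵉ ⟩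
    idSyn ⊗₁ σᵉ A D ≈⟨ id⊗wiring (exchange {a = a} {b = d}) ⟩
    wiring y₃       ∎

swap-head : ∀ {a b : Entry} {κ} → a ∷ b ∷ κ ↭ b ∷ a ∷ κ
swap-head = swap _ _ ↭-refl

≈-by-perm : ∀ {E A} (f g : SynHom E A) → inp f ≡ inp g → map p (ctl f) ↭ map p (ctl g) → out f ≡ out g → f ≈Syn g
≈-by-perm {A = A} f g refl π refl = ≈-by-eq f g refl (eq-exch (eq-refl (der f)) ↭-refl (++⁺ʳ (m (out f) A ∷ []) π))

flatten-left : ∀ (F : MorTree s t) (G : MorTree s′ t′) → tensorHom (leafM (tensorHom F) ⊛M G) ≈Syn tensorHom (F ⊛M G)
flatten-left {s′ = s′} F G = ≈-by-conf (tensorHom (leafM (tensorHom F) ⊛M G)) (tensorHom (F ⊛M G)) refl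
  (cong₂ (λ u v → map p (u ++ applyCtl G (project s′ (caser (var 0)))) ++ m (v ⅋ₜ build (applyOut G (project s′ (caser (var 0))))) _ ∷ [])
         (applyCtl-project-subst F (var 0) 0 (casel (var 0))) (applyOut-project-subst F (var 0) 0 (casel (var 0))))

flatten-right : ∀ (G : MorTree s′ t′) (F : MorTree s t) → tensorHom (G ⊛M leafM (tensorHom F)) ≈Syn tensorHom (G ⊛M F)
flatten-right {s′ = s′} G F = ≈-by-conf (tensorHom (G ⊛M leafM (tensorHom F))) (tensorHom (G ⊛M F)) refl
  (cong₂ (λ u v → map p (applyCtl G (project s′ (casel (var 0))) ++ u) ++ m (build (applyOut G (project s′ (casel (var 0)))) ⅋ₜ v) _ ∷ [])
         (applyCtl-project-subst F (var 0) 0 (caser (var 0))) (applyOut-project-subst F (var 0) 0 (caser (var 0))))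

wiringAfterTensor : ∀ (r : Rearrangement t u) (F : MorTree s t) → SynHom (fm s) (fm u)
wiringAfterTensor {s = s} r F = mor 0 (applyCtl F (projVar s)) (build (move r (applyOut F (projVar s))))
  (der-build (map p (applyCtl F (projVar s))) (move r (applyOut F (projVar s)))
             (exch (der-tensor F) (++⁺ˡ (map p (applyCtl F (projVar s))) (move-↭ r _))))

wiring∘tensor : ∀ (r : Rearrangement t u) (F : MorTree s t) → (wiring r ∘Syn tensorHom F) ≈Syn wiringAfterTensor r F
wiring∘tensor {u = u} {s = s} r F = ≈-by-eq (wiring r ∘Syn tensorHom F) (wiringAfterTensor r F) refl
  (eq-cast (wiring-after-build (map p (applyCtl F (projVar s))) r (applyOut F (projVar s)) (der-tensor F))
           (trans (cong (λ z → map p (applyCtl F (projVar s)) ++ m z (fm u) ∷ [])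
                        (sym (wiring-subst r (build (applyOut F (projVar s))))))
                  (sym (conf-∘ (wiring r) (tensorHom F))))
           refl)

tensorAfterWiring : ∀ (G : MorTree t u) (r : Rearrangement s t) → SynHom (fm s) (fm u)
tensorAfterWiring {s = s} G r = mor 0 (applyCtl G (move r (projVar s))) (build (applyOut G (move r (projVar s))))
  (der-build (map p (applyCtl G (move r (projVar s)))) (applyOut G (move r (projVar s)))
     (exch (der-apply [] G (move r (projVar s)) (exch (der-projVar s 0) (move-↭ r (projVar s))))
           (applyConf-split G (move r (projVar s)))))

tensor∘wiring : ∀ (G : MorTree t u) (r : Rearrangement s t) → (tensorHom G ∘Syn wiring r) ≈Syn tensorAfterWiring G r
tensor∘wiring {s = s} G r = ≈-by-eq (tensorHom G ∘Syn wiring r) (tensorAfterWiring G r) refl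
  (eq-cast (tensor-after-build [] G (move r (projVar s)) (exch (der-projVar s 0) (move-↭ r (projVar s))))
           (sym (trans (conf-∘ (tensorHom G) (wiring r)) (tensorHom-subst G (build (move r (projVar s))))))
           refl)

-- Naturality of α and σ: both composites compute the same outputs with
-- control areas that differ only in order.
α-natural : ∀ {A B D A′ B′ D′} {f : SynHom A A′} {g : SynHom B B′} {h : SynHom D D′} →
            (α⇒ ∘Syn ((f ⊗₁ g) ⊗₁ h)) ≈Syn ((f ⊗₁ (g ⊗₁ h)) ∘Syn α⇒)
α-natural {f = f} {g} {h} = begin
  α⇒ ∘Syn ((f ⊗₁ g) ⊗₁ h)
    ≈⟨ ∘-resp α⇒ α⇒ ((f ⊗₁ g) ⊗₁ h) (tensorHom F) (≈-refl {f = α⇒})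
              (flatten-left (leafM f ⊛M leafM g) (leafM h)) ⟩
  α⇒ ∘Syn tensorHom F
    ≈⟨ wiring∘tensor reassoc F ⟩
  wiringAfterTensor reassoc F
    ≈⟨ ≈-by-perm (wiringAfterTensor reassoc F) (tensorAfterWiring F′ reassoc) refl
                 (↭-reflexive (cong (map p) (++-assoc cf cg ch))) refl ⟩
  tensorAfterWiring F′ reassoc
    ≈⟨ tensor∘wiring F′ reassoc ⟨
  tensorHom F′ ∘Syn α⇒
    ≈⟨ ∘-resp (f ⊗₁ (g ⊗₁ h)) (tensorHom F′) α⇒ α⇒
              (flatten-right (leafM f) (leafM g ⊛M leafM h)) (≈-refl {f = α⇒}) ⟨
  (f ⊗₁ (g ⊗₁ h)) ∘Syn α⇒ ∎
  where
  open ≈-Reasoning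
  F  = (leafM f ⊛M leafM g) ⊛M leafM h
  F′ = leafM f ⊛M (leafM g ⊛M leafM h)
  cf = subs (inp f) (casel (casel (var 0))) (ctl f)
  cg = subs (inp g) (caser (casel (var 0))) (ctl g)
  ch = subs (inp h) (caser (var 0)) (ctl h)

σ-natural : ∀ {A B A′ B′} {f : SynHom A A′} {g : SynHom B B′} →
            (σ ∘Syn (f ⊗₁ g)) ≈Syn ((g ⊗₁ f) ∘Syn σ)
σ-natural {f = f} {g} = begin
  σ ∘Syn (f ⊗₁ g)
    ≈⟨ wiring∘tensor exchange F ⟩
  wiringAfterTensor exchange F
    ≈⟨ ≈-by-perm (wiringAfterTensor exchange F) (tensorAfterWiring F′ exchange) refl
                 (↭-trans (↭-reflexive (map-++ p cf cg))
                 (↭-trans (++-comm (map p cf) (map p cg)) (↭-reflexive (sym (map-++ p cg cf))))) refl ⟩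
  tensorAfterWiring F′ exchange
    ≈⟨ tensor∘wiring F′ exchange ⟨
  (g ⊗₁ f) ∘Syn σ ∎
  where
  open ≈-Reasoning
  F  = leafM f ⊛M leafM g
  F′ = leafM g ⊛M leafM f
  cf = subs (inp f) (casel (var 0)) (ctl f)
  cg = subs (inp g) (caser (var 0)) (ctl g)

λ⇒ : ∀ {A} → SynHom (⊥ᶠ ⅋ A) A
λ⇒ = mor 0 (postp (casel (var 0)) ∷ []) (caser (var 0)) (⅋-elim {κ = []} ax (⊥-elim {x = 0}) (ax {x = 0}))

ρ⇒ : ∀ {A} → SynHom (A ⅋ ⊥ᶠ) A
ρ⇒ = mor 0 (postp (caser (var 0)) ∷ []) (casel (var 0)) (exch (⅋-elim {κ = []} ax (ax {x = 0}) (⊥-elim {x = 0})) swap-head)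

-- The inverses need a p-term in the control area to connect ⊥ to.  It is
-- produced by a ∖-loop on the input x: ∖-intro gives 𝚢(x) and mkc(x,𝚢), and
-- ∖-elim of the latter against the axiom gives the p-term  loop  while
-- 𝚢(x) : A remains as output; ∖-β later collapses 𝚢(x) back to x.
loop : Tm
loop = postp↦ 2 (var 2) (mkc (var 0) 1)

der-loop : ∀ {A} → Der 0 A (p loop ∷ m (ap 1 (var 0)) A ∷ [])
der-loop {A} = ∖-elim {κ = m (ap 1 (var 0)) A ∷ []}
  (∖-intro {κ = []} {M = var 0} (ax {x = 0}) (ax {x = 1} {A = A})) (ax {x = 2})

loop-β : ∀ {x E A} κ M → Der x E (κ ++ m M A ∷ []) →
         Eq x E (κ ++ m (ap 1 M) A ∷ p (postp↦ 2 (var 2) (mkc M 1)) ∷ []) (κ ++ m M A ∷ [])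
loop-β {A = A} κ M d = ∖-β {κ = κ} {M = M} {y = 1} {N̄ = m (var 1) A ∷ []} {z = 2} {L̄ = []} {L = var 2} d ax ax

der-loop-⊥ : ∀ {A} → Der 0 A (p loop ∷ m (ap 1 (var 0)) A ∷ m (connect-to loop) ⊥ᶠ ∷ [])
der-loop-⊥ = ⊥-intro der-loop (here refl)

λ⇐ : ∀ {A} → SynHom A (⊥ᶠ ⅋ A)
λ⇐ = mor 0 (loop ∷ []) (connect-to loop ⅋ₜ ap 1 (var 0)) (⅋-intro {κ = p loop ∷ []} (exch der-loop-⊥ (prep _ swap-head)))

ρ⇐ : ∀ {A} → SynHom A (A ⅋ ⊥ᶠ)
ρ⇐ = mor 0 (loop ∷ []) (ap 1 (var 0) ⅋ₜ connect-to loop) (⅋-intro {κ = p loop ∷ []} der-loop-⊥)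

-- λ⇒ ∘ λ⇐ : ⅋-β, then ⊥-β removes postp(connect to loop), then ∖-β.
unitˡ-isoʳ : ∀ {A} → (λ⇒ {A} ∘Syn λ⇐) ≈Syn idSyn
unitˡ-isoʳ {A} = ≈-by-eq (λ⇒ ∘Syn λ⇐) idSyn refl
  (⅋-β {κ = p loop ∷ []} (exch der-loop-⊥ (prep _ swap-head)) (⊥-elim {x = 0}) (ax {x = 0})
   ⨾ eq-exch (⊥-β {κ = p loop ∷ m (ap 1 (var 0)) A ∷ []} der-loop (here refl)) (prep _ swap-head) ↭-refl
   ⨾ eq-exch (loop-β [] (var 0) ax) swap-head ↭-refl)

unitʳ-isoʳ : ∀ {A} → (ρ⇒ {A} ∘Syn ρ⇐) ≈Syn idSyn
unitʳ-isoʳ {A} = ≈-by-eq (ρ⇒ ∘Syn ρ⇐) idSyn refl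
  (eq-exch (⅋-β {κ = p loop ∷ []} der-loop-⊥ (ax {x = 0}) (⊥-elim {x = 0})) (prep _ swap-head) ↭-refl
   ⨾ ⊥-β {κ = p loop ∷ m (ap 1 (var 0)) A ∷ []} der-loop (here refl)
   ⨾ eq-exch (loop-β [] (var 0) ax) swap-head ↭-refl)

reverse-tail : ∀ {a b c d : Entry} → a ∷ b ∷ c ∷ d ∷ [] ↭ a ∷ d ∷ c ∷ b ∷ []
reverse-tail = prep _ (↭-trans (prep _ swap-head) (↭-trans swap-head (prep _ swap-head)))

rotate-last : ∀ {a b c : Entry} → a ∷ b ∷ c ∷ [] ↭ c ∷ a ∷ b ∷ []
rotate-last = ↭-trans (prep _ swap-head) swap-head

-- λ⇐ ∘ λ⇒ : rewire connect to(loop) to connect to(postp(casel x)), collapse the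
-- loop by ∖-β, then ⊥-η and ⅋-η give back the identity.
unitˡ-isoˡ : ∀ {A} → (λ⇐ {A} ∘Syn λ⇒) ≈Syn idSyn
unitˡ-isoˡ {A} = ≈-by-eq (λ⇐ ∘Syn λ⇒) idSyn refl
  (cong-⅋-intro {κ = p Pc ∷ p R′ ∷ []} {κ′ = []} inner ⨾ ⅋-η {κ = []} ax)
  where
  Pc = postp (casel (var 0))
  R′ = postp↦ 2 (var 2) (mkc (caser (var 0)) 1)
  rewire = ⊥-rewire {κ = p Pc ∷ p R′ ∷ m (ap 1 (caser (var 0))) A ∷ []}
                    (der-cutLast {κ = p Pc ∷ []} (der (λ⇒ {A})) der-loop) (there (here refl)) (here refl)
  collapse = loop-β (p Pc ∷ m (connect-to Pc) ⊥ᶠ ∷ []) (caser (var 0))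
                    (exch (⊥-intro (der (λ⇒ {A})) (here refl)) (prep _ swap-head))
  ⊥η = ⊥-η {κ = m (caser (var 0)) A ∷ []} {M = casel (var 0)}
           (exch (⅋-elim {κ = []} ax (ax {x = 0}) (ax {x = 0})) swap-head)
  inner = eq-exch rewire (prep _ (prep _ swap-head)) reverse-tail
        ⨾ eq-exch collapse ↭-refl rotate-last
        ⨾ eq-exch ⊥η ↭-refl swap-head

unitʳ-isoˡ : ∀ {A} → (ρ⇐ {A} ∘Syn ρ⇒) ≈Syn idSyn
unitʳ-isoˡ {A} = ≈-by-eq (ρ⇐ ∘Syn ρ⇒) idSyn refl
  (cong-⅋-intro {κ = p Pr ∷ p R′ ∷ []} {κ′ = []} inner ⨾ ⅋-η {κ = []} ax)
  where
  Pr = postp (caser (var 0))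
  R′ = postp↦ 2 (var 2) (mkc (casel (var 0)) 1)
  rewire = ⊥-rewire {κ = p Pr ∷ p R′ ∷ m (ap 1 (casel (var 0))) A ∷ []}
                    (der-cutLast {κ = p Pr ∷ []} (der (ρ⇒ {A})) der-loop) (there (here refl)) (here refl)
  collapse = loop-β (p Pr ∷ m (connect-to Pr) ⊥ᶠ ∷ []) (casel (var 0))
                    (exch (⊥-intro (der (ρ⇒ {A})) (here refl)) (prep _ swap-head))
  ⊥η = ⊥-η {κ = m (casel (var 0)) A ∷ []} {M = caser (var 0)} (⅋-elim {κ = []} ax (ax {x = 0}) (ax {x = 0}))
  inner = rewire ⨾ eq-exch collapse reverse-tail rotate-last ⨾ ⊥η

-- Naturality of the unitors: one ⅋-β step.
unitˡ-natural : ∀ {A A′} {f : SynHom A A′} → (λ⇒ ∘Syn (idSyn ⊗₁ f)) ≈Syn (f ∘Syn λ⇒)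
unitˡ-natural {A} {A′} {f} = ≈-by-eq (λ⇒ ∘Syn (idSyn ⊗₁ f)) (f ∘Syn λ⇒) refl
  (eq-cast (eq-exch β ↭-refl (shift (p (postp (casel (var 0)))) (map p cf) (m F A′ ∷ [])))
           (sym (conf-∘ λ⇒ (idSyn ⊗₁ f))) refl)
  where
  cf = subs (inp f) (caser (var 0)) (ctl f)
  F  = out f ⟦ inp f ≔ caser (var 0) ⟧
  β  = ⅋-β {κ = map p cf} {M₀ = casel (var 0)} {M₁ = F}
           (der-tensor (leafM (idSyn {⊥ᶠ}) ⊛M leafM f)) (⊥-elim {x = 0}) (ax {x = 0})

unitʳ-natural : ∀ {A A′} {f : SynHom A A′} → (ρ⇒ ∘Syn (f ⊗₁ idSyn)) ≈Syn (f ∘Syn ρ⇒)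
unitʳ-natural {A} {A′} {f} = ≈-by-eq (ρ⇒ ∘Syn (f ⊗₁ idSyn)) (f ∘Syn ρ⇒) refl
  (eq-cast (eq-exch β (++⁺ˡ (map p cf) swap-head)
                      (↭-trans (++⁺ˡ (map p cf) swap-head) (shift (p (postp (caser (var 0)))) (map p cf) (m F A′ ∷ []))))
           (sym (trans (conf-∘ ρ⇒ (f ⊗₁ idSyn))
                       (cong (λ z → map p z ++ p (postp (caser (F ⅋ₜ caser (var 0)))) ∷ m (casel (F ⅋ₜ caser (var 0))) A′ ∷ [])
                             (++-identityʳ cf))))
           refl)
  where
  cf = subs (inp f) (casel (var 0)) (ctl f)
  F  = out f ⟦ inp f ≔ casel (var 0) ⟧
  d  = der-cast (der-tensor (leafM f ⊛M leafM (idSyn {⊥ᶠ})))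
                (cong (λ z → map p z ++ m F A′ ∷ m (caser (var 0)) ⊥ᶠ ∷ []) (++-identityʳ cf))
  β  = ⅋-β {κ = map p cf} {M₀ = F} {M₁ = caser (var 0)} d (ax {x = 0}) (⊥-elim {x = 0})

-- Triangle: two ⅋-β steps on the three projections of (A ⅋ ⊥) ⅋ B.
triangle : ∀ {A B} → ((idSyn {A} ⊗₁ λ⇒ {B}) ∘Syn α⇒) ≈Syn (ρ⇒ ⊗₁ idSyn)
triangle {A} {B} = ≈-by-eq ((idSyn ⊗₁ λ⇒) ∘Syn α⇒) (ρ⇒ ⊗₁ idSyn) refl
  (cong-⅋-intro {κ = p (postp (casel (caser (a ⅋ₜ (b ⅋ₜ c))))) ∷ []} {κ′ = p (postp b) ∷ []}
     (eq-exch β₁ swap-head ↭-refl ⨾ eq-exch β₂ ↭-refl swap-head))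
  where
  a = casel (casel (var 0)) ; b = caser (casel (var 0)) ; c = caser (var 0)
  d : Der 0 ((A ⅋ ⊥ᶠ) ⅋ B) (m a A ∷ m b ⊥ᶠ ∷ m c B ∷ [])
  d = der-projVar ((leaf A ⊛ leaf ⊥ᶠ) ⊛ leaf B) 0
  β₁ = ⅋-β {κ = []} {M₀ = a} {M₁ = b ⅋ₜ c} (⅋-intro {κ = m a A ∷ []} d) (ax {x = 0}) (der (λ⇒ {B}))
  β₂ = ⅋-β {κ = m a A ∷ []} {M₀ = b} {M₁ = c} d (⊥-elim {x = 0}) (ax {x = 0})

syn-symmetricMonoidal : SymmetricMonoidal Syn _⅋_ ⊥ᶠ
syn-symmetricMonoidal = record
  { _⊗₁_          = _⊗₁_
  ; ⊗-resp        = λ {A} {B} {A′} {B′} {f} {f′} {g} {g′} → ⊗-resp f f′ g g′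
  ; ⊗-id          = λ {A} {B} → ⊗-id {A} {B}
  ; ⊗-∘           = λ {A} {B} {A′} {B′} {A″} {B″} {f} {f′} {g} {g′} → ⊗-∘ {f = f} {f′} {g} {g′}
  ; α⇒            = α⇒
  ; α⇐            = α⇐
  ; α-isoˡ        = λ {A} {B} {D} → α-isoˡ {A} {B} {D}
  ; α-isoʳ        = λ {A} {B} {D} → α-isoʳ {A} {B} {D}
  ; α-natural     = λ {A} {B} {D} {A′} {B′} {D′} {f} {g} {h} → α-natural {f = f} {g} {h}
  ; unitˡ⇒        = λ⇒
  ; unitˡ⇐        = λ⇐
  ; unitˡ-isoˡ    = λ {A} → unitˡ-isoˡ {A}
  ; unitˡ-isoʳ    = λ {A} → unitˡ-isoʳ {A}
  ; unitˡ-natural = λ {A} {A′} {f} → unitˡ-natural {f = f}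
  ; unitʳ⇒        = ρ⇒
  ; unitʳ⇐        = ρ⇐
  ; unitʳ-isoˡ    = λ {A} → unitʳ-isoˡ {A}
  ; unitʳ-isoʳ    = λ {A} → unitʳ-isoʳ {A}
  ; unitʳ-natural = λ {A} {A′} {f} → unitʳ-natural {f = f}
  ; σ             = σ
  ; σ-natural     = λ {A} {B} {A′} {B′} {f} {g} → σ-natural {f = f} {g}
  ; σ-involutive  = λ {A} {B} → σ-involutive {A} {B}
  ; triangle      = λ {A} {B} → triangle {A} {B}
  ; pentagon      = λ {A} {B} {D} {E} → pentagon {A} {B} {D} {E}
  ; hexagon       = λ {A} {B} {D} → hexagon {A} {B} {D}
  }

x₀ : Tm
x₀ = var 0

elimHom : ∀ {A B X} (cs : List Tm) (K N : Tm) → Der 2 B (map p cs ++ m K X ∷ m N A ∷ []) → SynHom (B ∖ A) X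
elimHom {X = X} cs K N d = mor 0 (postp↦ 2 N x₀ ∷ subs 2 (ap 2 x₀) cs) (K ⟦ 2 ≔ ap 2 x₀ ⟧)
  (der-cast (∖-elim {κ = []} {M = x₀} {ξ = map p cs ++ m K X ∷ []} (ax {x = 0}) (der-reassoc (map p cs) d))
            (cong (p (postp↦ 2 N x₀) ∷_) (conf-body cs K X)))
  where
  conf-body : ∀ cs K X → (map p cs ++ m K X ∷ []) ⟪ 2 ≔ ap 2 x₀ ⟫ ≡ map p (subs 2 (ap 2 x₀) cs) ++ m (K ⟦ 2 ≔ ap 2 x₀ ⟧) X ∷ []
  conf-body cs K X = trans (csubst-++ (map p cs) _ 2 (ap 2 x₀)) (cong (_++ _) (csubst-map cs 2 (ap 2 x₀)))

elimHom-conf : ∀ {A B X} cs K N (d : Der 2 B (map p cs ++ m K X ∷ m N A ∷ [])) →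
               conf (elimHom {A} cs K N d) ≡ p (postp↦ 2 N x₀) ∷ (map p cs ++ m K X ∷ []) ⟪ 2 ≔ ap 2 x₀ ⟫
elimHom-conf {X = X} cs K N d = cong (p (postp↦ 2 N x₀) ∷_)
  (sym (trans (csubst-++ (map p cs) _ 2 (ap 2 x₀)) (cong (_++ m (K ⟦ 2 ≔ ap 2 x₀ ⟧) X ∷ []) (csubst-map cs 2 (ap 2 x₀)))))

elimHom-≈ : ∀ {A B X} (h k : SynHom (B ∖ A) X) → inp h ≡ 0 → inp k ≡ 0 → ∀ ξ ξ′ N N′ →
            conf h ≡ p (postp↦ 2 N x₀) ∷ ξ ⟪ 2 ≔ ap 2 x₀ ⟫ →
            conf k ≡ p (postp↦ 2 N′ x₀) ∷ ξ′ ⟪ 2 ≔ ap 2 x₀ ⟫ →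
            Eq 2 B (ξ ++ m N A ∷ []) (ξ′ ++ m N′ A ∷ []) → h ≈Syn k
elimHom-≈ h k refl inp-k ξ ξ′ N N′ conf-h conf-k e = ≈-by-eq h k (sym inp-k)
  (eq-cast (cong-∖-elim {κ = []} {κ′ = []} {M = x₀} {M′ = x₀} (eq-refl ax) e) (sym conf-h) (sym conf-k))

ctl₂ : ∀ {B D} → SynHom B D → List Tm
ctl₂ f = subs (inp f) (var 2) (ctl f)

out₂ : ∀ {B D} → SynHom B D → Tm
out₂ f = out f ⟦ inp f ≔ var 2 ⟧

der₂ : ∀ {B D} (f : SynHom B D) → Der 2 B (map p (ctl₂ f) ++ m (out₂ f) D ∷ [])
der₂ f = der-cast (der-rename 2 (der f)) (conf-subst f (inp f) (var 2))

eq₂ : ∀ {B D} (f g : SynHom B D) → f ≈Syn g →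
      Eq 2 B (map p (ctl₂ f) ++ m (out₂ f) D ∷ []) (map p (ctl₂ g) ++ m (out₂ g) D ∷ [])
eq₂ f g e = eq-cast (eq-rename 2 e) (conf-subst f (inp f) (var 2))
                    (trans (rename-subst g (inp f) (var 2)) (conf-subst g (inp g) (var 2)))

ctl₂-∘ : ∀ {B D C} (f : SynHom B D) (g : SynHom D C) → ctl₂ (g ∘Syn f) ≡ ctl₂ f ++ subs 2 (out₂ f) (ctl₂ g)
ctl₂-∘ f g = trans (map-++ _ (ctl f) _)
  (cong (ctl₂ f ++_) (trans (subs-compose (ctl g) (inp g) (out f) (inp f) (var 2) (ctl-closed g))
                            (sym (subs-compose (ctl g) (inp g) (var 2) 2 (out₂ f) (ctl-closed g)))))

out₂-∘ : ∀ {B D C} (f : SynHom B D) (g : SynHom D C) → out₂ (g ∘Syn f) ≡ out₂ g ⟦ 2 ≔ out₂ f ⟧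
out₂-∘ f g = trans (subst-compose (out g) (inp g) (out f) (inp f) (var 2) (out-closed g))
                   (sym (subst-compose (out g) (inp g) (var 2) 2 (out₂ f) (out-closed g)))

-- The functor - ∖ A on a morphism f : B → D: ∖-intro on the output of f
-- followed by ∖-elim on the input,
--   x₀ : B ∖ A ▷ postp(2 ↦ 𝚢₁(f(2)), x₀), mkc(f(2), 𝚢₁)[2:=𝚢₂(x₀)] : D ∖ A .
ξL : ∀ {B D} A (f : SynHom B D) → Conf
ξL {D = D} A f = map p (ctl₂ f) ++ m (mkc (out₂ f) 1) (D ∖ A) ∷ []

der-L : ∀ {B D} A (f : SynHom B D) → Der 2 B (map p (ctl₂ f) ++ m (mkc (out₂ f) 1) (D ∖ A) ∷ m (ap 1 (out₂ f)) A ∷ [])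
der-L A f = exch (∖-intro {κ = map p (ctl₂ f)} {M = out₂ f} (der₂ f) (ax {x = 1} {A = A})) (++⁺ˡ (map p (ctl₂ f)) swap-head)

der-ξL : ∀ {B D} A (f : SynHom B D) → Der 2 B (ξL A f ++ m (ap 1 (out₂ f)) A ∷ [])
der-ξL A f = der-reassoc (map p (ctl₂ f)) (der-L A f)

ξL-closed : ∀ {B D} A (f : SynHom B D) → ClosedC 2 (ξL A f)
ξL-closed A f = ++⁻ˡ (ξL A f) (der-closed (der-ξL A f))

ξL-subst : ∀ {B D} A (f : SynHom B D) M →
           ξL A f ⟪ 2 ≔ M ⟫ ≡ map p (subs 2 M (ctl₂ f)) ++ m (mkc (out₂ f ⟦ 2 ≔ M ⟧) 1) (D ∖ A) ∷ []
ξL-subst {D = D} A f M = trans (csubst-++ (map p (ctl₂ f)) _ 2 M)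
                                (cong (_++ m (mkc (out₂ f ⟦ 2 ≔ M ⟧) 1) (D ∖ A) ∷ []) (csubst-map (ctl₂ f) 2 M))

L₁ : ∀ A {B D} → SynHom B D → SynHom (B ∖ A) (D ∖ A)
L₁ A f = elimHom (ctl₂ f) (mkc (out₂ f) 1) (ap 1 (out₂ f)) (der-L A f)

L₁-conf : ∀ {B D} A (f : SynHom B D) → conf (L₁ A f) ≡ p (postp↦ 2 (ap 1 (out₂ f)) x₀) ∷ ξL A f ⟪ 2 ≔ ap 2 x₀ ⟫
L₁-conf A f = elimHom-conf (ctl₂ f) (mkc (out₂ f) 1) (ap 1 (out₂ f)) (der-L A f)

L-resp : ∀ A {B D} {f g : SynHom B D} → f ≈Syn g → L₁ A f ≈Syn L₁ A g
L-resp A {f = f} {g} e = elimHom-≈ (L₁ A f) (L₁ A g) refl refl (ξL A f) (ξL A g) _ _ (L₁-conf A f) (L₁-conf A g)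
  (eq-exch (cong-∖-intro {κ = map p (ctl₂ f)} {κ′ = map p (ctl₂ g)} {y = 1} (eq₂ f g e) (eq-refl (ax {x = 1} {A = A})))
           (↭-trans (++⁺ˡ (map p (ctl₂ f)) swap-head) (↭-reflexive (sym (++-assoc (map p (ctl₂ f)) _ _))))
           (↭-trans (++⁺ˡ (map p (ctl₂ g)) swap-head) (↭-reflexive (sym (++-assoc (map p (ctl₂ g)) _ _)))))

-- L₁ A id is an instance of ∖-η.
L-id : ∀ A {B} → L₁ A (idSyn {B}) ≈Syn idSyn
L-id A {B} = ≈-by-eq (L₁ A idSyn) idSyn refl
  (eq-exch (∖-η {κ = []} {M = x₀} {A = B} {B = A} {u = 2} {v = 1} ax) swap-head ↭-refl)

L₁∘L₁-conf : ∀ A {B D C} (f : SynHom B D) (g : SynHom D C) →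
  conf (L₁ A g ∘Syn L₁ A f) ≡ p (postp↦ 2 (ap 1 (out₂ f)) x₀)
    ∷ (map p (ctl₂ f) ++ p (postp↦ 2 (ap 1 (out₂ g)) (mkc (out₂ f) 1)) ∷ ξL A g ⟪ 2 ≔ ap 2 (mkc (out₂ f) 1) ⟫) ⟪ 2 ≔ ap 2 x₀ ⟫
L₁∘L₁-conf A f g = trans (conf-∘ (L₁ A g) (L₁ A f))
  (trans (cong (λ z → R ∷ map p (subs 2 (ap 2 x₀) (ctl₂ f)) ++ z ⟪ 0 ≔ K ⟫) (L₁-conf A g))
  (cong (R ∷_) (sym (trans (csubst-++ (map p (ctl₂ f)) _ 2 (ap 2 x₀))
    (cong₂ _++_ (csubst-map (ctl₂ f) 2 (ap 2 x₀))
      (cong (p (postp↦ 2 (ap 1 (out₂ g)) K) ∷_)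
        (trans (csubst-compose (ξL A g) 2 (ap 2 (mkc (out₂ f) 1)) 2 (ap 2 x₀) (ξL-closed A g))
               (sym (csubst-compose (ξL A g) 2 (ap 2 x₀) 0 K (ξL-closed A g))))))))))
  where
  R = p (postp↦ 2 (ap 1 (out₂ f)) x₀)
  K = mkc (out₂ f) 1 ⟦ 2 ≔ ap 2 x₀ ⟧

-- Functoriality: one ∖-β step cancels the inner ∖-intro/∖-elim pair.
L-∘ : ∀ A {B D C} {f : SynHom B D} {g : SynHom D C} → L₁ A (g ∘Syn f) ≈Syn (L₁ A g ∘Syn L₁ A f)
L-∘ A {C = C} {f} {g} = elimHom-≈ (L₁ A (g ∘Syn f)) (L₁ A g ∘Syn L₁ A f) refl refl (ξL A (g ∘Syn f)) ξ′ _ _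
  (L₁-conf A (g ∘Syn f)) (L₁∘L₁-conf A f g) (eq-sym (eq-cast (eq-exch β (↭-sym before) after) refl (sym renamed)))
  where
  F = out₂ f
  Q = out₂ g ⟦ 2 ≔ F ⟧
  c = subs 2 F (ctl₂ g)
  R = p (postp↦ 2 (ap 1 (out₂ g)) (mkc F 1))
  Z = ξL A g ⟪ 2 ≔ ap 2 (mkc F 1) ⟫
  ξ′ = map p (ctl₂ f) ++ R ∷ Z
  β = ∖-β {κ = map p (ctl₂ f)} {M = F} {y = 1} {N̄ = m (var 1) A ∷ []} {z = 2} {L̄ = ξL A g} {L = ap 1 (out₂ g)}
          (der₂ f) ax (der-ξL A g)
  before : ξ′ ++ m (ap 1 F) A ∷ [] ↭ map p (ctl₂ f) ++ m (ap 1 F) A ∷ R ∷ Z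
  before = ↭-trans (↭-reflexive (++-assoc (map p (ctl₂ f)) _ _)) (++⁺ˡ (map p (ctl₂ f)) (↭-sym (∷↭∷ʳ _ (R ∷ Z))))
  after : map p (ctl₂ f) ++ m (ap 1 Q) A ∷ ξL A g ⟪ 2 ≔ F ⟫
          ↭ (map p (ctl₂ f ++ c) ++ m (mkc Q 1) (C ∖ A) ∷ []) ++ m (ap 1 Q) A ∷ []
  after = ↭-trans (↭-reflexive (cong (λ z → map p (ctl₂ f) ++ m (ap 1 Q) A ∷ z) (ξL-subst A g F)))
    (↭-trans (++⁺ˡ (map p (ctl₂ f)) (∷↭∷ʳ _ (map p c ++ m (mkc Q 1) (C ∖ A) ∷ [])))
    (↭-reflexive (trans (sym (++-assoc (map p (ctl₂ f)) _ _))
      (cong (_++ m (ap 1 Q) A ∷ []) (trans (sym (++-assoc (map p (ctl₂ f)) (map p c) _))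
                                           (cong (_++ m (mkc Q 1) (C ∖ A) ∷ []) (sym (map-++ p (ctl₂ f) c))))))))
  renamed : ξL A (g ∘Syn f) ++ m (ap 1 (out₂ (g ∘Syn f))) A ∷ []
            ≡ (map p (ctl₂ f ++ c) ++ m (mkc Q 1) (C ∖ A) ∷ []) ++ m (ap 1 Q) A ∷ []
  renamed = cong₂ (λ u v → (map p u ++ m (mkc v 1) (C ∖ A) ∷ []) ++ m (ap 1 v) A ∷ []) (ctl₂-∘ f g) (out₂-∘ f g)

der-unit : ∀ A B → Der 0 B (m (ap 1 x₀) A ∷ m (mkc x₀ 1) (B ∖ A) ∷ [])
der-unit A B = ∖-intro {κ = []} {M = x₀} (ax {x = 0}) (ax {x = 1} {A = A})

unit : ∀ A B → SynHom B (A ⅋ (B ∖ A))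
unit A B = mor 0 [] (ap 1 x₀ ⅋ₜ mkc x₀ 1) (⅋-intro {κ = []} (der-unit A B))

der-proj-swap : ∀ A B → Der 2 (A ⅋ B) (map p [] ++ m (caser (var 2)) B ∷ m (casel (var 2)) A ∷ [])
der-proj-swap A B = exch (⅋-elim {κ = []} (ax {x = 2}) (ax {x = 2}) (ax {x = 2})) swap-head

counit : ∀ A B → SynHom ((A ⅋ B) ∖ A) B
counit A B = elimHom [] (caser (var 2)) (casel (var 2)) (der-proj-swap A B)

-- Naturality of the unit: after the tuple β-law, one ∖-β step.
η-natural : ∀ A {B D} {f : SynHom B D} → ((idSyn ⊗₁ L₁ A f) ∘Syn unit A B) ≈Syn (unit A D ∘Syn f)
η-natural A {B} {D} {f} =
  eq-cast (reduce ⨾ cong-⅋-intro {κ = map p (applyCtl G L)} {κ′ = map p (subs (inp f) x₀ (ctl f))} collapse)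
          (sym (trans (conf-∘ (idSyn ⊗₁ L₁ A f) (unit A B)) (tensorHom-subst G (build L))))
          (sym rhs-conf)
  where
  G = leafM (idSyn {A}) ⊛M leafM (L₁ A f)
  L : Tuple (leaf A ⊛ leaf (B ∖ A))
  L = leafT (ap 1 x₀) ⊛T leafT (mkc x₀ 1)
  reduce = tensor-after-build [] G L (der-unit A B)
  F = out₂ f
  S = subs 2 (ap 2 (mkc x₀ 1)) (ctl₂ f)
  F′ = F ⟦ 2 ≔ ap 2 (mkc x₀ 1) ⟧
  S₀ = subs 2 x₀ (ctl₂ f)
  F₀ = F ⟦ 2 ≔ x₀ ⟧
  R = postp↦ 2 (ap 1 F) (mkc x₀ 1)
  β = eq-cast (∖-β {κ = []} {M = x₀} {y = 1} {N̄ = m (var 1) A ∷ []} {z = 2} {L̄ = ξL A f} {L = ap 1 F}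
                   (ax {x = 0}) (ax {x = 1}) (der-ξL A f))
              (cong (λ z → m (ap 1 x₀) A ∷ p R ∷ z) (ξL-subst A f (ap 2 (mkc x₀ 1))))
              (cong (λ z → m (ap 1 F₀) A ∷ z) (ξL-subst A f x₀))
  closed-ctl = ++⁻ˡ (map p (ctl₂ f)) (der-closed (der₂ f))
  closed-out = All.head (++⁻ʳ (map p (ctl₂ f)) (der-closed (der₂ f)))
  collapse = eq-cast
    (eq-exch β (↭-sym (shift (m (ap 1 x₀) A) (p R ∷ map p S) (m (mkc F′ 1) (D ∖ A) ∷ [])))
               (↭-sym (shift (m (ap 1 F₀) A) (map p S₀) (m (mkc F₀ 1) (D ∖ A) ∷ []))))
    (cong₂ (λ u v → p R ∷ map p u ++ m (ap 1 x₀) A ∷ m (mkc v 1) (D ∖ A) ∷ [])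
           (sym (subs-compose (ctl₂ f) 2 (ap 2 x₀) 0 (mkc x₀ 1) closed-ctl))
           (sym (subst-compose F 2 (ap 2 x₀) 0 (mkc x₀ 1) closed-out)))
    (cong₂ (λ u v → map p u ++ m (ap 1 v) A ∷ m (mkc v 1) (D ∖ A) ∷ [])
           (subs-compose (ctl f) (inp f) (var 2) 2 x₀ (ctl-closed f))
           (subst-compose (out f) (inp f) (var 2) 2 x₀ (out-closed f)))
  O = out f ⟦ inp f ≔ x₀ ⟧
  rhs-conf : conf (unit A D ∘Syn f) ⟪ inp f ≔ x₀ ⟫
             ≡ map p (subs (inp f) x₀ (ctl f)) ++ m (ap 1 O ⅋ₜ mkc O 1) (A ⅋ (D ∖ A)) ∷ []
  rhs-conf = trans (conf-subst (unit A D ∘Syn f) (inp f) x₀)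
    (cong (λ z → map p (subs (inp f) x₀ z) ++ m (ap 1 O ⅋ₜ mkc O 1) (A ⅋ (D ∖ A)) ∷ []) (++-identityʳ (ctl f)))

∘counit-conf : ∀ A {B D} (f : SynHom B D) →
  conf (f ∘Syn counit A B) ≡ p (postp↦ 2 (casel (var 2)) x₀)
    ∷ (map p (subs (inp f) (caser (var 2)) (ctl f)) ++ m (out f ⟦ inp f ≔ caser (var 2) ⟧) D ∷ []) ⟪ 2 ≔ ap 2 x₀ ⟫
∘counit-conf A {B} {D} f = trans (conf-∘ f (counit A B)) (cong (p (postp↦ 2 (casel (var 2)) x₀) ∷_)
  (trans (conf-subst f y (caser (ap 2 x₀)))
    (sym (trans (csubst-++ (map p (subs y (caser (var 2)) (ctl f))) _ 2 (ap 2 x₀))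
      (cong₂ _++_ (trans (csubst-map _ 2 (ap 2 x₀)) (cong (map p) (subs-compose (ctl f) y (caser (var 2)) 2 (ap 2 x₀) (ctl-closed f))))
                  (cong (λ z → m z D ∷ []) (subst-compose (out f) y (caser (var 2)) 2 (ap 2 x₀) (out-closed f))))))))
  where y = inp f

counit∘L₁-conf : ∀ A {B D} (h : SynHom B (A ⅋ D)) →
  conf (counit A D ∘Syn L₁ A h) ≡ p (postp↦ 2 (ap 1 (out₂ h)) x₀)
    ∷ (map p (ctl₂ h) ++ p (postp↦ 2 (casel (var 2)) (mkc (out₂ h) 1)) ∷ m (caser (ap 2 (mkc (out₂ h) 1))) D ∷ []) ⟪ 2 ≔ ap 2 x₀ ⟫
counit∘L₁-conf A {D = D} h = trans (conf-∘ (counit A D) (L₁ A h)) (cong (p (postp↦ 2 (ap 1 (out₂ h)) x₀) ∷_)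
  (sym (trans (csubst-++ (map p (ctl₂ h)) _ 2 (ap 2 x₀)) (cong (_++ tail) (csubst-map (ctl₂ h) 2 (ap 2 x₀))))))
  where
  H = out₂ h ⟦ 2 ≔ ap 2 x₀ ⟧
  tail = p (postp↦ 2 (casel (var 2)) (mkc H 1)) ∷ m (caser (ap 2 (mkc H 1))) D ∷ []

-- Both sides in ∖-elim form: ∖-β and ⅋-β reduce the premise of the right-hand side
-- to that of the left-hand side.
ε-natural : ∀ A {B D} {f : SynHom B D} → (f ∘Syn counit A B) ≈Syn (counit A D ∘Syn L₁ A (idSyn ⊗₁ f))
ε-natural A {B} {D} {f} = elimHom-≈ (f ∘Syn counit A B) (counit A D ∘Syn L₁ A h) refl refl _ _ (casel (var 2)) (ap 1 H)
  (∘counit-conf A f) (counit∘L₁-conf A h)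
  (eq-sym (eq-cast (eq-exch β₁ (↭-trans (++⁺ˡ (map p cs) (↭-trans swap-head (prep _ swap-head)))
                                         (↭-reflexive (sym (++-assoc (map p cs) _ _)))) ↭-refl
                    ⨾ eq-exch β₂ ↭-refl (++⁺ˡ (map p cs) swap-head))
                   refl
                   (trans (cong₂ (λ u v → map p u ++ m v D ∷ m (casel (var 2)) A ∷ []) ctl-eq out-eq)
                          (sym (++-assoc (map p (subs (inp f) (caser (var 2)) (ctl f))) _ _)))))
  where
  h = idSyn {A} ⊗₁ f
  cs = ctl₂ h
  H = out₂ h
  Fc = (out f ⟦ inp f ≔ caser (var 0) ⟧) ⟦ 0 ≔ var 2 ⟧
  β₁ = ∖-β {κ = map p cs} {M = H} {y = 1} {N̄ = m (var 1) A ∷ []} {z = 2} {L̄ = m (caser (var 2)) D ∷ []} {L = casel (var 2)}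
           (der₂ h) (ax {x = 1}) (der-proj-swap A D)
  split : Der 2 (A ⅋ B) (map p cs ++ m (casel (var 2)) A ∷ m Fc D ∷ [])
  split = der-cast (der-rename 2 (der-tensor (leafM (idSyn {A}) ⊛M leafM f)))
    (trans (csubst-++ (map p (subs (inp f) (caser (var 0)) (ctl f))) _ 0 (var 2))
           (cong (_++ m (casel (var 2)) A ∷ m Fc D ∷ []) (csubst-map _ 0 (var 2))))
  β₂ = ⅋-β {κ = map p cs} {M₀ = casel (var 2)} {M₁ = Fc} split (ax {x = 0}) (ax {x = 0})
  ctl-eq : cs ≡ subs (inp f) (caser (var 2)) (ctl f)
  ctl-eq = subs-compose (ctl f) (inp f) (caser (var 0)) 0 (var 2) (ctl-closed f)
  out-eq : Fc ≡ out f ⟦ inp f ≔ caser (var 2) ⟧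
  out-eq = subst-compose (out f) (inp f) (caser (var 0)) 0 (var 2) (out-closed f)

-- Triangle identities: ∖-β followed by ⅋-η, resp. ∖-β, ⅋-β and L-id.
zig : ∀ A B → ((idSyn ⊗₁ counit A B) ∘Syn unit A (A ⅋ B)) ≈Syn idSyn
zig A B = eq-cast (reduce ⨾ cong-⅋-intro {κ = p P ∷ []} {κ′ = []} collapse ⨾ ⅋-η {κ = []} (ax {x = 0}))
  (sym (trans (conf-∘ (idSyn ⊗₁ counit A B) (unit A (A ⅋ B))) (tensorHom-subst G (build L)))) refl
  where
  G = leafM (idSyn {A}) ⊛M leafM (counit A B)
  L : Tuple (leaf A ⊛ leaf ((A ⅋ B) ∖ A))
  L = leafT (ap 1 x₀) ⊛T leafT (mkc x₀ 1)
  reduce = tensor-after-build [] G L (der-unit A (A ⅋ B))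
  P = postp↦ 2 (casel (var 2)) (mkc x₀ 1)
  collapse = eq-exch (∖-β {κ = []} {M = x₀} {y = 1} {N̄ = m (var 1) A ∷ []} {z = 2}
                          {L̄ = m (caser (var 2)) B ∷ []} {L = casel (var 2)}
                          (ax {x = 0}) (ax {x = 1}) (der-proj-swap A B)) swap-head ↭-refl

zag : ∀ A B → (counit A (B ∖ A) ∘Syn L₁ A (unit A B)) ≈Syn idSyn
zag A B = ≈-trans {f = counit A (B ∖ A) ∘Syn L₁ A (unit A B)} {g = L₁ A idSyn} {h = idSyn}
  (elimHom-≈ (counit A (B ∖ A) ∘Syn L₁ A (unit A B)) (L₁ A idSyn) refl refl ξ (ξL A idSyn)
             (ap 1 U) (ap 1 (var 2)) refl (L₁-conf A idSyn)
             (eq-exch β₁ (↭-trans swap-head (prep _ swap-head)) ↭-refl ⨾ eq-exch β₂ ↭-refl swap-head))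
  (L-id A)
  where
  U = ap 1 (var 2) ⅋ₜ mkc (var 2) 1
  C = B ∖ A
  ξ = p (postp↦ 2 (casel (var 2)) (mkc U 1)) ∷ m (caser (ap 2 (mkc U 1))) C ∷ []
  d : Der 2 B (m (ap 1 (var 2)) A ∷ m (mkc (var 2) 1) C ∷ [])
  d = ∖-intro {κ = []} {M = var 2} (ax {x = 2}) (ax {x = 1} {A = A})
  β₁ = ∖-β {κ = []} {M = U} {y = 1} {N̄ = m (var 1) A ∷ []} {z = 2} {L̄ = m (caser (var 2)) C ∷ []} {L = casel (var 2)}
           (⅋-intro {κ = []} d) (ax {x = 1}) (der-proj-swap A C)
  β₂ = ⅋-β {κ = []} {M₀ = ap 1 (var 2)} {M₁ = mkc (var 2) 1} d (ax {x = 0}) (ax {x = 0})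

syn-leftClosed : LeftClosed Syn syn-symmetricMonoidal (λ A B → B ∖ A)
syn-leftClosed = record
  { L₁        = L₁
  ; L-resp    = λ A {B} {D} {f} {g} → L-resp A {f = f} {g}
  ; L-id      = L-id
  ; L-∘       = λ A {B} {D} {E} {f} {g} → L-∘ A {f = f} {g}
  ; η         = unit
  ; ε         = counit
  ; η-natural = λ A {B} {D} {f} → η-natural A {f = f}
  ; ε-natural = λ A {B} {D} {f} → ε-natural A {f = f}
  ; zig       = zig
  ; zag       = zag
  }

theorem3p5 : IsCategory Syn
             × Σ (SymmetricMonoidal Syn _⅋_ ⊥ᶠ)
                 (λ M → LeftClosed Syn M (λ A B → B ∖ A))
theorem3p5 = syn-isCategory , syn-symmetricMonoidal , syn-leftClosed
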